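{- Let $k\ge 1$ and $n\ge k-1$ be integers. The total number of standard Young tableaux of skew shape $\lambda/(k-1)$, summed over all partitions $\lambda$ of $n$ having at most three parts (with $(k-1)\subset\lambda$), filled with the numbers $1,2,\ldots,n-k+1$, equals \[ \sum_{i} r_{k,i}\, M_{i+n-k+1}, \] where $M_m$ is the $m$th Motzkin number and the coefficients $r_{k,i}$ are defined by \[ \sum_{k=1}^\infty r_k(x)y^k=\sum_{k=1}^\infty\sum_{i=0}^{k-1} r_{k,i}x^i y^k=\frac{y}{(1-y)\left(1+(1-x)y+y^2\right)}. \]
   Context: A partition $\lambda=(\lambda_1,\lambda_2,\ldots)$ of $n$ is a weakly decreasing sequence of positive integers summing to $n$; its parts are the $\lambda_i$. For partitions $\mu\subset\lambda$ (i.e. $\mu_i\le\lambda_i$ for all $i$), the skew diagram $\lambda/\mu$ is the Young diagram of $\lambda$ (left-justified rows of $\lambda_i$ boxes) with that of $\mu$ removed; $(k-1)$ denotes the one-part partition with part $k-1$ (the empty partition if $k=1$). A standard Young tableau of skew shape $\lambda/\mu$ is a filling of the $|\lambda|-|\mu|$ boxes with $1,2,\ldots,|\lambda|-|\mu|$, each used once, increasing left to right along rows and top to bottom down columns. The Motzkin numbers are $M_m=\sum_{k=0}^{\lfloor m/2\rfloor}\frac{m!}{k!(k+1)!(m-2k)!}$, with generating function $\sum_m M_m x^m=\frac{1-x-\sqrt{1-2x-3x^2}}{2x^2}$; $M_m=0$ is understood for $m<0$ is not needed since $i\ge 0$. -}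

module Defs where

open import Data.Nat as ℕ using (ℕ; zero; suc; _+_; _*_; _∸_; _≤_; _<_; _≥_; _!; _/_)
open import Data.Nat.Properties using (m*n≢0; _!≢0)
open import Data.Integer as ℤ using (ℤ; +_; -[1+_])
open import Data.List using (List; []; _∷_; length; map; upTo; concat)
open import Data.Nat.ListAction using (sum)
open import Data.List.Relation.Unary.All using (All)
open import Data.List.Relation.Unary.Linked using (Linked)
open import Data.List.Relation.Binary.Permutation.Propositional using (_↭_)
open import Data.Product using (_×_; _,_)
open import Relation.Binary.PropositionalEquality using (_≡_)

sumℕ : ℕ → (ℕ → ℕ) → ℕ
sumℕ zero    f = 0
sumℕ (suc m) f = sumℕ m f + f m

sumℤ : ℕ → (ℕ → ℤ) → ℤ
sumℤ zero    f = + 0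
sumℤ (suc m) f = sumℤ m f ℤ.+ f m

motzkinTerm : ℕ → ℕ → ℕ
motzkinTerm m j =
  _/_ (m !) ((j ! * (suc j) !) * (m ∸ (j + j)) !)
      {{m*n≢0 (j ! * (suc j) !) ((m ∸ (j + j)) !)
         {{m*n≢0 (j !) ((suc j) !) {{j !≢0}} {{(suc j) !≢0}}}}
         {{(m ∸ (j + j)) !≢0}}}}

motzkin : ℕ → ℕ
motzkin m = sumℕ (suc (m / 2)) (motzkinTerm m)

-- Formal power series in two variables x, y with integer coefficients.
-- A series F is represented by its coefficient function:
--   F k i = [y^k x^i] F.

Series : Set
Series = ℕ → ℕ → ℤ

_⋆_ : Series → Series → Series
(F ⋆ G) k i = sumℤ (suc k) λ a → sumℤ (suc i) λ b → F a b ℤ.* G (k ∸ a) (i ∸ b)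

seriesY : Series
seriesY 1 0 = + 1
seriesY _ _ = + 0

oneMinusY : Series
oneMinusY 0 0 = + 1
oneMinusY 1 0 = -[1+ 0 ]
oneMinusY _ _ = + 0

quadFactor : Series
quadFactor 0 0 = + 1
quadFactor 1 0 = + 1
quadFactor 1 1 = -[1+ 0 ]
quadFactor 2 0 = + 1
quadFactor _ _ = + 0

-- r is the series  Σ_k Σ_i r_{k,i} x^i y^k  equal to
--   y / ((1 - y)(1 + (1 - x) y + y^2)),
-- i.e. r · ((1 - y)(1 + (1 - x) y + y^2)) = y  (the denominator has
-- constant term 1, so this determines r uniquely).
IsRGenFun : Series → Set
IsRGenFun r = ∀ k i → (r ⋆ (oneMinusY ⋆ quadFactor)) k i ≡ seriesY k i

part : List ℕ → ℕ → ℕ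
part []       _       = 0
part (p ∷ ps) zero    = p
part (p ∷ ps) (suc i) = part ps i

IsPartitionOf : ℕ → List ℕ → Set
IsPartitionOf n λ′ = Linked _≥_ λ′ × All (1 ≤_) λ′ × sum λ′ ≡ n

_⊆ₚ_ : List ℕ → List ℕ → Set
μ ⊆ₚ λ′ = ∀ i → part μ i ≤ part λ′ i

onePart : ℕ → List ℕ
onePart zero    = []
onePart (suc m) = suc m ∷ []

-- A tableau of skew shape is stored row by row: row i lists the entries
-- of the boxes (i, j), μ_i ≤ j < λ_i, from left to right.
Tableau : Set
Tableau = List (List ℕ)

row : Tableau → ℕ → List ℕ
row []       _       = []
row (r ∷ rs) zero    = r
row (r ∷ rs) (suc i) = row rs i

nth : List ℕ → ℕ → ℕ
nth []       _       = 0
nth (x ∷ xs) zero    = x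
nth (x ∷ xs) (suc j) = nth xs j

InSkew : List ℕ → List ℕ → ℕ → ℕ → Set
InSkew λ′ μ i j = part μ i ≤ j × j < part λ′ i

entry : List ℕ → Tableau → ℕ → ℕ → ℕ
entry μ T i j = nth (row T i) (j ∸ part μ i)

oneTo : ℕ → List ℕ
oneTo m = map suc (upTo m)

record IsSkewSYT (λ′ μ : List ℕ) (T : Tableau) : Set where
  field
    numRows   : length T ≡ length λ′
    rowLength : ∀ i → length (row T i) ≡ part λ′ i ∸ part μ i
    entries   : concat T ↭ oneTo (sum λ′ ∸ sum μ)
    rowIncr   : ∀ i j → InSkew λ′ μ i j → InSkew λ′ μ i (suc j) →
                entry μ T i j < entry μ T i (suc j)
    colIncr   : ∀ i j → InSkew λ′ μ i j → InSkew λ′ μ (suc i) j →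
                entry μ T i j < entry μ T (suc i) j

Counted : ℕ → ℕ → List ℕ × Tableau → Set
Counted n k (λ′ , T) =
  IsPartitionOf n λ′ × length λ′ ≤ 3 × onePart (k ∸ 1) ⊆ₚ λ′ ×
  IsSkewSYT λ′ (onePart (k ∸ 1)) T

-- Record a standard tableau of shape λ/(k − 1), λ with at most three rows, by its rows R₀, R₁, R₂.
-- Inserting the entries 1, 2, … in order walks the point (λ₀ − λ₁, λ₁ − λ₂) through the quadrant
-- ℕ × ℕ from (k − 1, 0), with steps (1, 0), (−1, 1), (0, −1) for the three rows, so the tableaux are
-- counted by the number W_N(k − 1, 0) of quadrant walks of length N = n − k + 1. Summing over
-- rectangles, W_N(p, q) = Σ_{a ≤ p, b ≤ q} P_N(a + b), where P_N(h) counts Motzkin paths of length N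
-- between heights 0 and h; hence the count is Σ_{a < k} P_N(a).
-- On the other side, y/((1 − y)(1 + (1 − x) y + y²)) is the unique solution of
-- r = y + x y r − x y² r + y³ r, and r_k = Σ_{a < k} Q_a where Σ_a Q_a yᵃ = 1/(1 + (1 − x) y + y²).
-- Replacing xⁱ by M_{i+N} sends Q_a to P_N(a), and M_m = Σ_j C(m, 2j) Cat_j = P_m(0).

module Submission where

module LatticePaths where
  open import Data.Nat
  open import Data.Nat.Properties
  open import Data.Nat.Combinatorics
    using (_C_; nCk+nC[k+1]≡[n+1]C[k+1]; nCk≡nC[n∸k]; nCk≡n!/k![n-k]!; k![n∸k]!∣n!; k>n⇒nCk≡0)
  open import Data.Nat.DivMod using (m*n/n≡m; m/n*n≡m; m≡m%n+[m/n]*n; m%n<n; m/n*n≤m)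
  open import Data.Nat.Tactic.RingSolver using (solve-∀)
  open import Algebra.Properties.CommutativeSemigroup +-commutativeSemigroup
    using (interchange; x∙yz≈y∙xz; xy∙z≈xz∙y)
  open import Data.Product using (_×_; _,_; proj₁; proj₂)
  open import Data.Sum using (_⊎_; inj₁; inj₂)
  open import Function using (_∘_)
  open import Relation.Binary.PropositionalEquality
  open ≡-Reasoning
  open import Defs using (sumℕ; motzkinTerm; motzkin)

  sumℕ-suc : ∀ n (f : ℕ → ℕ) → sumℕ (suc n) f ≡ f 0 + sumℕ n (f ∘ suc)
  sumℕ-suc zero    f = sym (+-identityʳ (f 0))
  sumℕ-suc (suc n) f = trans (cong (_+ f (suc n)) (sumℕ-suc n f)) (+-assoc (f 0) _ _)

  sumℕ-+ : ∀ n (f g : ℕ → ℕ) → sumℕ n (λ j → f j + g j) ≡ sumℕ n f + sumℕ n g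
  sumℕ-+ zero    f g = refl
  sumℕ-+ (suc n) f g rewrite sumℕ-+ n f g = interchange (sumℕ n f) (sumℕ n g) (f n) (g n)

  sumℕ-cong : ∀ n {f g : ℕ → ℕ} → (∀ j → j < n → f j ≡ g j) → sumℕ n f ≡ sumℕ n g
  sumℕ-cong zero    f≗g = refl
  sumℕ-cong (suc n) f≗g = cong₂ _+_ (sumℕ-cong n (λ j j<n → f≗g j (m<n⇒m<1+n j<n))) (f≗g n ≤-refl)

  sumℕ-zero : ∀ n {f : ℕ → ℕ} → (∀ j → j < n → f j ≡ 0) → sumℕ n f ≡ 0
  sumℕ-zero zero    f≗0 = refl
  sumℕ-zero (suc n) f≗0 = cong₂ _+_ (sumℕ-zero n (λ j j<n → f≗0 j (m<n⇒m<1+n j<n))) (f≗0 n ≤-refl)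

  prev : (ℕ → ℕ) → ℕ → ℕ
  prev f zero    = 0
  prev f (suc h) = f h

  pascal : ∀ n k → suc n C k ≡ prev (n C_) k + n C k
  pascal n zero    = refl
  pascal n (suc k) = sym (nCk+nC[k+1]≡[n+1]C[k+1] n k)

  C*factorials : ∀ k d → ((k + d) C k) * (k ! * d !) ≡ (k + d) !
  C*factorials k d =
    subst (λ e → ((k + d) C k) * (k ! * e !) ≡ (k + d) !) (m+n∸m≡n k d)
      (trans (cong (_* (k ! * (k + d ∸ k) !)) (nCk≡n!/k![n-k]! k≤k+d))
             (m/n*n≡m {{k !* (k + d ∸ k) !≢0}} (k![n∸k]!∣n! k≤k+d)))
    where k≤k+d = m≤m+n k d

  C-sym : ∀ k d → (k + d) C k ≡ (k + d) C d
  C-sym k d = trans (nCk≡nC[n∸k] (m≤m+n k d)) (cong ((k + d) C_) (m+n∸m≡n k d))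

  -- Walks of n steps ±1 from height h down to 0 that never go below 0.
  dyckPaths : ℕ → ℕ → ℕ
  dyckPaths zero    zero    = 1
  dyckPaths zero    (suc h) = 0
  dyckPaths (suc n) h       = dyckPaths n (suc h) + prev (dyckPaths n) h

  dyckPaths-high : ∀ {n h} → n < h → dyckPaths n h ≡ 0
  dyckPaths-high {zero}  {suc h} _         = refl
  dyckPaths-high {suc n} {suc h} (s≤s n<h) =
    cong₂ _+_ (dyckPaths-high (m<n⇒m<1+n (m<n⇒m<1+n n<h))) (dyckPaths-high n<h)

  dyckPaths-odd : ∀ n h u → n ≡ suc (h + (u + u)) → dyckPaths n h ≡ 0
  dyckPaths-odd (suc n) zero    zero    refl = refl
  dyckPaths-odd (suc n) zero    (suc u) eq =
    cong (_+ 0) (dyckPaths-odd n 1 u (trans (suc-injective eq) (cong suc (+-suc u u))))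
  dyckPaths-odd (suc n) (suc h) zero    eq = cong₂ _+_
    (dyckPaths-high (subst (_< suc (suc h)) (sym (trans (suc-injective eq) (cong suc (+-identityʳ h)))) ≤-refl))
    (dyckPaths-odd n h zero (suc-injective eq))
  dyckPaths-odd (suc n) (suc h) (suc u) eq = cong₂ _+_
    (dyckPaths-odd n (suc (suc h)) u (trans (suc-injective eq) (shuffle h u)))
    (dyckPaths-odd n h (suc u) (suc-injective eq))
    where shuffle : ∀ h u → suc h + (suc u + suc u) ≡ suc (suc (suc h) + (u + u))
          shuffle = solve-∀

  ballot : ∀ n h u → n ≡ h + (u + u) → dyckPaths n h + prev (n C_) u ≡ n C u
  ballot zero    zero    zero    refl = refl
  ballot (suc n) zero    (suc u) eq   = begin
      dyckPaths n 1 + 0 + suc n C u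
    ≡⟨ cong₂ _+_ (+-identityʳ _) (pascal n u) ⟩
      dyckPaths n 1 + (prev (n C_) u + n C u)
    ≡⟨ sym (+-assoc (dyckPaths n 1) _ _) ⟩
      dyckPaths n 1 + prev (n C_) u + n C u
    ≡⟨ cong (_+ n C u) (ballot n 1 u (trans n≡u+1+u (+-suc u u))) ⟩
      n C u + n C u
    ≡⟨ cong (n C u +_) (subst (λ m → m C u ≡ m C suc u) (sym n≡u+1+u) (C-sym u (suc u))) ⟩
      n C u + n C suc u
    ≡⟨ nCk+nC[k+1]≡[n+1]C[k+1] n u ⟩
      suc n C suc u
    ∎
    where n≡u+1+u = suc-injective eq
  ballot (suc n) (suc h) zero    eq   =
    trans (cong (λ z → z + dyckPaths n h + 0) (dyckPaths-high n<h+2)) (ballot n h zero (suc-injective eq))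
    where n<h+2 = subst (_< suc (suc h)) (sym (trans (suc-injective eq) (+-identityʳ h))) (m<n⇒m<1+n (n<1+n h))
  ballot (suc n) (suc h) (suc u) eq   = begin
      dyckPaths n (suc (suc h)) + dyckPaths n h + suc n C u
    ≡⟨ cong (dyckPaths n (suc (suc h)) + dyckPaths n h +_) (pascal n u) ⟩
      dyckPaths n (suc (suc h)) + dyckPaths n h + (prev (n C_) u + n C u)
    ≡⟨ interchange (dyckPaths n (suc (suc h))) (dyckPaths n h) (prev (n C_) u) (n C u) ⟩
      (dyckPaths n (suc (suc h)) + prev (n C_) u) + (dyckPaths n h + n C u)
    ≡⟨ cong₂ _+_ (ballot n (suc (suc h)) u (trans (suc-injective eq) (shuffle h u)))
                 (ballot n h (suc u) (suc-injective eq)) ⟩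
      n C u + n C suc u
    ≡⟨ nCk+nC[k+1]≡[n+1]C[k+1] n u ⟩
      suc n C suc u
    ∎
    where
      shuffle : ∀ h u → h + (suc u + suc u) ≡ suc (suc h) + (u + u)
      shuffle = solve-∀

  -- From the ballot identity with h = 0: Cat_j = C(2j, j) − C(2j, j−1).
  catalan : ∀ j → dyckPaths (j + j) 0 * (j ! * suc j !) ≡ (j + j) !
  catalan zero    = refl
  catalan (suc i) = +-cancelʳ-≡ (j * F) (X * P) F (begin
      X * P + j * F
    ≡⟨ cong (X * P +_) (sym Y*P≡j*F) ⟩
      X * P + Y * P
    ≡⟨ sym (*-distribʳ-+ P X Y) ⟩
      (X + Y) * P
    ≡⟨ cong (_* P) (ballot (j + j) 0 j refl) ⟩
      Z * P
    ≡⟨ Z*P≡[1+j]*F ⟩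
      F + j * F
    ∎)
    where
      j = suc i
      X = dyckPaths (j + j) 0
      Y = (j + j) C i
      Z = (j + j) C j
      F = (j + j) !
      P = j ! * suc j !
      Y*P≡j*F : Y * P ≡ j * F
      Y*P≡j*F = begin
          Y * ((j * i !) * suc j !)
        ≡⟨ reassoc Y j (i !) (suc j !) ⟩
          j * (Y * (i ! * suc j !))
        ≡⟨ cong (λ m → j * ((m C i) * (i ! * suc j !))) (+-suc i (suc i)) ⟨
          j * (((i + suc j) C i) * (i ! * suc j !))
        ≡⟨ cong (j *_) (C*factorials i (suc j)) ⟩
          j * (i + suc j) !
        ≡⟨ cong (λ m → j * m !) (+-suc i (suc i)) ⟩
          j * F
        ∎
        where reassoc : ∀ y a b c → y * ((a * b) * c) ≡ a * (y * (b * c))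
              reassoc = solve-∀
      Z*P≡[1+j]*F : Z * P ≡ F + j * F
      Z*P≡[1+j]*F = trans (reassoc Z j (j !)) (cong (suc j *_) (C*factorials j j))
        where reassoc : ∀ z a b → z * (b * (suc a * b)) ≡ suc a * (z * (b * b))
              reassoc = solve-∀

  sumℕ-pascal : ∀ m (g : ℕ → ℕ) →
    sumℕ (suc (suc m)) (λ j → (suc m C j) * g j) ≡
    sumℕ (suc m) (λ j → (m C j) * g (suc j)) + sumℕ (suc m) (λ j → (m C j) * g j)
  sumℕ-pascal m g = begin
      sumℕ (suc (suc m)) (λ j → (suc m C j) * g j)
    ≡⟨ sumℕ-suc (suc m) _ ⟩
      g0 + sumℕ (suc m) (λ j → (suc m C suc j) * g (suc j))
    ≡⟨ cong (g0 +_) (sumℕ-cong (suc m) (λ j _ → pascal-term j)) ⟩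
      g0 + sumℕ (suc m) (λ j → (m C j) * g (suc j) + (m C suc j) * g (suc j))
    ≡⟨ cong (g0 +_) (sumℕ-+ (suc m) _ _) ⟩
      g0 + (A + B)
    ≡⟨ x∙yz≈y∙xz g0 A B ⟩
      A + (g0 + B)
    ≡⟨ cong (A +_) (sumℕ-suc (suc m) (λ j → (m C j) * g j)) ⟨
      A + sumℕ (suc (suc m)) (λ j → (m C j) * g j)
    ≡⟨ cong (λ c → A + (sumℕ (suc m) (λ j → (m C j) * g j) + c * g (suc m))) (k>n⇒nCk≡0 (n<1+n m)) ⟩
      A + (sumℕ (suc m) (λ j → (m C j) * g j) + 0)
    ≡⟨ cong (A +_) (+-identityʳ _) ⟩
      A + sumℕ (suc m) (λ j → (m C j) * g j)
    ∎
    where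
      g0 = (m C 0) * g 0
      A = sumℕ (suc m) (λ j → (m C j) * g (suc j))
      B = sumℕ (suc m) (λ j → (m C suc j) * g (suc j))
      pascal-term : ∀ j → (suc m C suc j) * g (suc j) ≡ (m C j) * g (suc j) + (m C suc j) * g (suc j)
      pascal-term j = trans (cong (_* g (suc j)) (sym (nCk+nC[k+1]≡[n+1]C[k+1] m j)))
                            (*-distribʳ-+ (g (suc j)) (m C j) (m C suc j))

  motzkinStep : (ℕ → ℕ) → ℕ → ℕ
  motzkinStep f h = f (suc h) + f h + prev f h

  -- Walks of m steps +1, 0, −1 from height h down to 0 that never go below 0.
  motzkinPaths : ℕ → ℕ → ℕ
  motzkinPaths zero    zero    = 1
  motzkinPaths zero    (suc h) = 0
  motzkinPaths (suc m) h       = motzkinStep (motzkinPaths m) h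

  -- Choose which j of the m steps are not flat; they form a Dyck path.
  motzkinPaths-dyckPaths : ∀ m h → motzkinPaths m h ≡ sumℕ (suc m) (λ j → (m C j) * dyckPaths j h)
  motzkinPaths-dyckPaths zero    zero    = refl
  motzkinPaths-dyckPaths zero    (suc h) = refl
  motzkinPaths-dyckPaths (suc m) h       = begin
      motzkinPaths m (suc h) + motzkinPaths m h + prev (motzkinPaths m) h
    ≡⟨ cong₂ (λ a b → a + b + prev (motzkinPaths m) h)
             (motzkinPaths-dyckPaths m (suc h)) (motzkinPaths-dyckPaths m h) ⟩
      Σ[ (λ j → dyckPaths j (suc h)) ] + Σ[ (λ j → dyckPaths j h) ] + prev (motzkinPaths m) h
    ≡⟨ cong (Σ[ (λ j → dyckPaths j (suc h)) ] + Σ[ (λ j → dyckPaths j h) ] +_) (prev-motzkinPaths h) ⟩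
      Σ[ (λ j → dyckPaths j (suc h)) ] + Σ[ (λ j → dyckPaths j h) ] + Σ[ (λ j → prev (dyckPaths j) h) ]
    ≡⟨ xy∙z≈xz∙y Σ[ (λ j → dyckPaths j (suc h)) ] Σ[ (λ j → dyckPaths j h) ] _ ⟩
      Σ[ (λ j → dyckPaths j (suc h)) ] + Σ[ (λ j → prev (dyckPaths j) h) ] + Σ[ (λ j → dyckPaths j h) ]
    ≡⟨ cong (_+ Σ[ (λ j → dyckPaths j h) ]) (sym (sumℕ-+ (suc m) _ _)) ⟩
      sumℕ (suc m) (λ j → (m C j) * dyckPaths j (suc h) + (m C j) * prev (dyckPaths j) h)
        + Σ[ (λ j → dyckPaths j h) ]
    ≡⟨ cong (_+ Σ[ (λ j → dyckPaths j h) ])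
            (sumℕ-cong (suc m) (λ j _ → sym (*-distribˡ-+ (m C j) _ _))) ⟩
      Σ[ (λ j → dyckPaths (suc j) h) ] + Σ[ (λ j → dyckPaths j h) ]
    ≡⟨ sumℕ-pascal m (λ j → dyckPaths j h) ⟨
      sumℕ (suc (suc m)) (λ j → (suc m C j) * dyckPaths j h)
    ∎
    where
      Σ[_] : (ℕ → ℕ) → ℕ
      Σ[ f ] = sumℕ (suc m) (λ j → (m C j) * f j)
      prev-motzkinPaths : ∀ h → prev (motzkinPaths m) h ≡ Σ[ (λ j → prev (dyckPaths j) h) ]
      prev-motzkinPaths zero    = sym (sumℕ-zero (suc m) (λ j _ → *-zeroʳ (m C j)))
      prev-motzkinPaths (suc h) = motzkinPaths-dyckPaths m h

  motzkinTerm-paths : ∀ m j → j + j ≤ m → motzkinTerm m j ≡ (m C (j + j)) * dyckPaths (j + j) 0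
  motzkinTerm-paths m j 2j≤m =
    trans (cong (λ t → (t / Den) {{Den≢0}}) m!≡)
          (m*n/n≡m ((m C (j + j)) * dyckPaths (j + j) 0) Den {{Den≢0}})
    where
      Den = (j ! * suc j !) * (m ∸ (j + j)) !
      Den≢0 = m*n≢0 (j ! * suc j !) ((m ∸ (j + j)) !)
                {{m*n≢0 (j !) (suc j !) {{j !≢0}} {{suc j !≢0}}}} {{(m ∸ (j + j)) !≢0}}
      m!≡ : m ! ≡ ((m C (j + j)) * dyckPaths (j + j) 0) * Den
      m!≡ = begin
          m !
        ≡⟨ cong _! (m+[n∸m]≡n 2j≤m) ⟨
          (j + j + (m ∸ (j + j))) !
        ≡⟨ C*factorials (j + j) (m ∸ (j + j)) ⟨
          ((j + j + (m ∸ (j + j))) C (j + j)) * ((j + j) ! * (m ∸ (j + j)) !)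
        ≡⟨ cong (λ n → (n C (j + j)) * ((j + j) ! * (m ∸ (j + j)) !)) (m+[n∸m]≡n 2j≤m) ⟩
          (m C (j + j)) * ((j + j) ! * (m ∸ (j + j)) !)
        ≡⟨ cong (λ c → (m C (j + j)) * (c * (m ∸ (j + j)) !)) (catalan j) ⟨
          (m C (j + j)) * ((dyckPaths (j + j) 0 * (j ! * suc j !)) * (m ∸ (j + j)) !)
        ≡⟨ reassoc (m C (j + j)) (dyckPaths (j + j) 0) (j ! * suc j !) ((m ∸ (j + j)) !) ⟩
          ((m C (j + j)) * dyckPaths (j + j) 0) * Den
        ∎
        where reassoc : ∀ b d p q → b * ((d * p) * q) ≡ (b * d) * (p * q)
              reassoc = solve-∀

  sumℕ-evens : ∀ (g : ℕ → ℕ) → (∀ j → g (suc (j + j)) ≡ 0) → ∀ t →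
    sumℕ (suc (t + t)) g ≡ sumℕ (suc t) (λ j → g (j + j)) ×
    sumℕ (suc (suc (t + t))) g ≡ sumℕ (suc t) (λ j → g (j + j))
  sumℕ-evens g g-odd zero    = refl , trans (cong (g 0 +_) (g-odd 0)) (+-identityʳ _)
  sumℕ-evens g g-odd (suc t) =
    up-to-even , trans (cong (sumℕ (suc (suc t + suc t)) g +_) (g-odd (suc t))) (trans (+-identityʳ _) up-to-even)
    where
      up-to-even : sumℕ (suc (suc t + suc t)) g ≡ sumℕ (suc (suc t)) (λ j → g (j + j))
      up-to-even = trans (cong (λ n → sumℕ (suc n) g) (+-suc (suc t) t))
                         (cong₂ _+_ (proj₂ (sumℕ-evens g g-odd t)) (cong g (sym (+-suc (suc t) t))))

  n*2≡n+n : ∀ n → n * 2 ≡ n + n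
  n*2≡n+n = solve-∀

  even⊎odd : ∀ m → m ≡ m / 2 + m / 2 ⊎ m ≡ suc (m / 2 + m / 2)
  even⊎odd m with m % 2 | m%n<n m 2 | m≡m%n+[m/n]*n m 2
  ... | zero          | _               | eq = inj₁ (trans eq (n*2≡n+n (m / 2)))
  ... | suc zero      | _               | eq = inj₂ (trans eq (cong suc (n*2≡n+n (m / 2))))
  ... | suc (suc _)   | s≤s (s≤s ())    | _

  motzkin-motzkinPaths : ∀ m → motzkin m ≡ motzkinPaths m 0
  motzkin-motzkinPaths m = begin
      motzkin m
    ≡⟨ sumℕ-cong (suc (m / 2)) (λ j j≤m/2 → motzkinTerm-paths m j (double≤m j≤m/2)) ⟩
      sumℕ (suc (m / 2)) (λ j → g (j + j))
    ≡⟨ sumℕ-over-evens (even⊎odd m) ⟨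
      sumℕ (suc m) g
    ≡⟨ motzkinPaths-dyckPaths m 0 ⟨
      motzkinPaths m 0
    ∎
    where
      g : ℕ → ℕ
      g j = (m C j) * dyckPaths j 0
      g-odd : ∀ j → g (suc (j + j)) ≡ 0
      g-odd j = trans (cong ((m C suc (j + j)) *_) (dyckPaths-odd (suc (j + j)) 0 j refl)) (*-zeroʳ (m C suc (j + j)))
      double≤m : ∀ {j} → j < suc (m / 2) → j + j ≤ m
      double≤m (s≤s j≤m/2) =
        ≤-trans (+-mono-≤ j≤m/2 j≤m/2) (subst (_≤ m) (n*2≡n+n (m / 2)) (m/n*n≤m m 2))
      sumℕ-over-evens : m ≡ m / 2 + m / 2 ⊎ m ≡ suc (m / 2 + m / 2) →
                        sumℕ (suc m) g ≡ sumℕ (suc (m / 2)) (λ j → g (j + j))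
      sumℕ-over-evens (inj₁ eq) = trans (cong (λ n → sumℕ (suc n) g) eq) (proj₁ (sumℕ-evens g g-odd (m / 2)))
      sumℕ-over-evens (inj₂ eq) = trans (cong (λ n → sumℕ (suc n) g) eq) (proj₂ (sumℕ-evens g g-odd (m / 2)))

  chamberStep : (ℕ → ℕ → ℕ) → ℕ → ℕ → ℕ
  chamberStep F p q = F (suc p) q + prev (λ p′ → F p′ (suc q)) p + prev (F p) q

  -- Walks of m steps (1, 0), (−1, 1), (0, −1) from (p, q) that stay in ℕ × ℕ: with
  -- (p, q) = (λ₀ − λ₁, λ₁ − λ₂) they add a box to row 0, 1 or 2 of a shape λ.
  chamberWalks : ℕ → ℕ → ℕ → ℕ
  chamberWalks zero    p q = 1
  chamberWalks (suc m) p q = chamberStep (chamberWalks m) p q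

  stripSum : (ℕ → ℕ) → ℕ → ℕ → ℕ
  stripSum f p b = sumℕ (suc p) (λ a → f (a + b))

  blockSum : (ℕ → ℕ) → ℕ → ℕ → ℕ
  blockSum f p q = sumℕ (suc q) (stripSum f p)

  stripSum-step : ∀ f p b →
    stripSum f p (suc b) + stripSum f p b ≡ stripSum f (suc p) b + prev (λ p′ → stripSum f p′ (suc b)) p
  stripSum-step f zero    b = trans (+-comm (f (suc b)) (f b)) (sym (+-identityʳ _))
  stripSum-step f (suc p) b = begin
      stripSum f p (suc b) + f (suc p + suc b) + stripSum f (suc p) b
    ≡⟨ cong (λ n → stripSum f p (suc b) + f n + stripSum f (suc p) b) (+-suc (suc p) b) ⟩
      stripSum f p (suc b) + f (suc (suc p) + b) + stripSum f (suc p) b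
    ≡⟨ swap₁₃ (stripSum f p (suc b)) (f (suc (suc p) + b)) (stripSum f (suc p) b) ⟩
      stripSum f (suc p) b + f (suc (suc p) + b) + stripSum f p (suc b)
    ∎
    where swap₁₃ : ∀ x y z → x + y + z ≡ z + y + x
          swap₁₃ = solve-∀

  stripSum-motzkinStep : ∀ f p b →
    stripSum (motzkinStep f) p b ≡ stripSum f p (suc b) + stripSum f p b + stripSum (prev f) p b
  stripSum-motzkinStep f p b =
    trans (sumℕ-cong (suc p) (λ a _ → cong (λ n → f n + f (a + b) + prev f (a + b)) (sym (+-suc a b))))
          (trans (sumℕ-+ (suc p) _ _) (cong (_+ stripSum (prev f) p b) (sumℕ-+ (suc p) _ _)))

  stripSum-prev-zero : ∀ f p → stripSum (prev f) p 0 ≡ prev (λ p′ → stripSum f p′ 0) p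
  stripSum-prev-zero f zero    = refl
  stripSum-prev-zero f (suc p) = sumℕ-suc (suc p) (λ a → prev f (a + 0))

  stripSum-prev-suc : ∀ f p b → stripSum (prev f) p (suc b) ≡ stripSum f p b
  stripSum-prev-suc f p b = sumℕ-cong (suc p) (λ a _ → cong (prev f) (+-suc a b))

  prev-+ : ∀ f g h → prev f h + prev g h ≡ prev (λ x → f x + g x) h
  prev-+ f g zero    = refl
  prev-+ f g (suc h) = refl

  prev-blockSum : ∀ f p q → prev (blockSum f p) q + stripSum f p q ≡ blockSum f p q
  prev-blockSum f p zero    = refl
  prev-blockSum f p (suc q) = refl

  blockSum-motzkinStep : ∀ f p q → blockSum (motzkinStep f) p q ≡ chamberStep (blockSum f) p q
  blockSum-motzkinStep f p zero    = begin
      stripSum (motzkinStep f) p 0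
    ≡⟨ stripSum-motzkinStep f p 0 ⟩
      stripSum f p 1 + stripSum f p 0 + stripSum (prev f) p 0
    ≡⟨ cong₂ _+_ (stripSum-step f p 0) (stripSum-prev-zero f p) ⟩
      stripSum f (suc p) 0 + prev (λ p′ → stripSum f p′ 1) p + prev (λ p′ → stripSum f p′ 0) p
    ≡⟨ +-assoc (stripSum f (suc p) 0) _ _ ⟩
      stripSum f (suc p) 0 + (prev (λ p′ → stripSum f p′ 1) p + prev (λ p′ → stripSum f p′ 0) p)
    ≡⟨ cong (stripSum f (suc p) 0 +_) (trans (+-comm (prev (λ p′ → stripSum f p′ 1) p) _)
                                             (prev-+ (λ p′ → stripSum f p′ 0) (λ p′ → stripSum f p′ 1) p)) ⟩
      stripSum f (suc p) 0 + prev (λ p′ → blockSum f p′ 1) p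
    ≡⟨ +-identityʳ _ ⟨
      chamberStep (blockSum f) p 0
    ∎
  blockSum-motzkinStep f p (suc q) = begin
      blockSum (motzkinStep f) p q + stripSum (motzkinStep f) p (suc q)
    ≡⟨ cong₂ _+_ (blockSum-motzkinStep f p q)
                 (trans (stripSum-motzkinStep f p (suc q)) (cong (S₂ + S₁ +_) (stripSum-prev-suc f p q))) ⟩
      (B + P + prev (blockSum f p) q) + (S₂ + S₁ + S₀)
    ≡⟨ regroup B P (prev (blockSum f p) q) S₂ S₁ S₀ ⟩
      B + P + (S₂ + S₁) + (prev (blockSum f p) q + S₀)
    ≡⟨ cong₂ (λ x y → B + P + x + y) (stripSum-step f p (suc q)) (prev-blockSum f p q) ⟩
      B + P + (stripSum f (suc p) (suc q) + P′) + blockSum f p q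
    ≡⟨ cong (_+ blockSum f p q) (interchange B P (stripSum f (suc p) (suc q)) P′) ⟩
      (B + stripSum f (suc p) (suc q)) + (P + P′) + blockSum f p q
    ≡⟨ cong (λ x → B + stripSum f (suc p) (suc q) + x + blockSum f p q) (prev-+ _ _ p) ⟩
      chamberStep (blockSum f) p (suc q)
    ∎
    where
      B  = blockSum f (suc p) q
      P  = prev (λ p′ → blockSum f p′ (suc q)) p
      P′ = prev (λ p′ → stripSum f p′ (suc (suc q))) p
      S₂ = stripSum f p (suc (suc q))
      S₁ = stripSum f p (suc q)
      S₀ = stripSum f p q
      regroup : ∀ a b c d e g → (a + b + c) + (d + e + g) ≡ a + b + (d + e) + (c + g)
      regroup = solve-∀

  blockSum-motzkinPaths-zero : ∀ p q → blockSum (motzkinPaths 0) p q ≡ 1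
  blockSum-motzkinPaths-zero p q = begin
      blockSum (motzkinPaths 0) p q
    ≡⟨ sumℕ-suc q (stripSum (motzkinPaths 0) p) ⟩
      stripSum (motzkinPaths 0) p 0 + sumℕ q (λ b → stripSum (motzkinPaths 0) p (suc b))
    ≡⟨ cong₂ _+_ corner (sumℕ-zero q (λ b _ → off-corner b)) ⟩
      1
    ∎
    where
      corner : stripSum (motzkinPaths 0) p 0 ≡ 1
      corner = trans (sumℕ-suc p _) (cong (1 +_) (sumℕ-zero p (λ _ _ → refl)))
      off-corner : ∀ b → stripSum (motzkinPaths 0) p (suc b) ≡ 0
      off-corner b = sumℕ-zero (suc p) (λ a _ → cong (motzkinPaths 0) (+-suc a b))

  chamberStep-cong : ∀ {F G} → (∀ p q → F p q ≡ G p q) → ∀ p q → chamberStep F p q ≡ chamberStep G p q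
  chamberStep-cong {F} {G} F≗G p q = cong₂ _+_ (cong₂ _+_ (F≗G (suc p) q) (prev-cong p)) (prev-cong′ q)
    where
      prev-cong : ∀ p → prev (λ p′ → F p′ (suc q)) p ≡ prev (λ p′ → G p′ (suc q)) p
      prev-cong zero    = refl
      prev-cong (suc p) = F≗G p (suc q)
      prev-cong′ : ∀ q → prev (F p) q ≡ prev (G p) q
      prev-cong′ zero    = refl
      prev-cong′ (suc q) = F≗G p q

  chamberWalks-blockSum : ∀ m p q → chamberWalks m p q ≡ blockSum (motzkinPaths m) p q
  chamberWalks-blockSum zero    p q = sym (blockSum-motzkinPaths-zero p q)
  chamberWalks-blockSum (suc m) p q =
    trans (chamberStep-cong (chamberWalks-blockSum m) p q) (sym (blockSum-motzkinStep (motzkinPaths m) p q))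

  chamberWalks-axis : ∀ m u → chamberWalks m u 0 ≡ sumℕ (suc u) (motzkinPaths m)
  chamberWalks-axis m u =
    trans (chamberWalks-blockSum m u 0) (sumℕ-cong (suc u) (λ a _ → cong (motzkinPaths m) (+-identityʳ a)))


module GeneratingFunction where
  open import Data.Nat as ℕ using (ℕ; zero; suc; _∸_; _<_; s≤s)
  import Data.Nat.Properties as ℕ
  open import Data.Nat.Induction using (<-rec)
  open import Data.Integer using (ℤ; +_; _+_; _*_; -_; _-_)
  open import Data.Integer.Properties
  open import Data.Integer.Tactic.RingSolver using (solve-∀)
  open import Algebra.Properties.CommutativeSemigroup +-commutativeSemigroup using (interchange)
  open import Function using (_∘_)
  open import Relation.Binary.PropositionalEquality
  open ≡-Reasoning
  open import Defs using (sumℕ; sumℤ; Series; _⋆_; seriesY; oneMinusY; quadFactor; IsRGenFun; motzkin)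
  open LatticePaths using (motzkinPaths; motzkin-motzkinPaths)

  sumℤ-suc : ∀ n (f : ℕ → ℤ) → sumℤ (suc n) f ≡ f 0 + sumℤ n (f ∘ suc)
  sumℤ-suc zero    f = trans (+-identityˡ (f 0)) (sym (+-identityʳ (f 0)))
  sumℤ-suc (suc n) f = trans (cong (_+ f (suc n)) (sumℤ-suc n f)) (+-assoc (f 0) _ _)

  sumℤ-cong : ∀ n {f g : ℕ → ℤ} → (∀ j → j < n → f j ≡ g j) → sumℤ n f ≡ sumℤ n g
  sumℤ-cong zero    f≗g = refl
  sumℤ-cong (suc n) f≗g = cong₂ _+_ (sumℤ-cong n (λ j j<n → f≗g j (ℕ.m<n⇒m<1+n j<n))) (f≗g n ℕ.≤-refl)

  sumℤ-zero : ∀ n {f : ℕ → ℤ} → (∀ j → j < n → f j ≡ + 0) → sumℤ n f ≡ + 0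
  sumℤ-zero zero    f≗0 = refl
  sumℤ-zero (suc n) f≗0 = cong₂ _+_ (sumℤ-zero n (λ j j<n → f≗0 j (ℕ.m<n⇒m<1+n j<n))) (f≗0 n ℕ.≤-refl)

  sumℤ-+ : ∀ n (f g : ℕ → ℤ) → sumℤ n (λ j → f j + g j) ≡ sumℤ n f + sumℤ n g
  sumℤ-+ zero    f g = refl
  sumℤ-+ (suc n) f g rewrite sumℤ-+ n f g = interchange (sumℤ n f) (sumℤ n g) (f n) (g n)

  sumℤ-neg : ∀ n (f : ℕ → ℤ) → sumℤ n (λ j → - f j) ≡ - sumℤ n f
  sumℤ-neg zero    f = refl
  sumℤ-neg (suc n) f rewrite sumℤ-neg n f = sym (neg-distrib-+ (sumℤ n f) (f n))

  sumℤ-*ʳ : ∀ n (f : ℕ → ℤ) c → sumℤ n (λ j → f j * c) ≡ sumℤ n f * c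
  sumℤ-*ʳ zero    f c = sym (*-zeroˡ c)
  sumℤ-*ʳ (suc n) f c rewrite sumℤ-*ʳ n f c = sym (*-distribʳ-+ c (sumℤ n f) (f n))

  sumℤ-comm : ∀ n m (F : ℕ → ℕ → ℤ) →
    sumℤ n (λ i → sumℤ m (λ a → F a i)) ≡ sumℤ m (λ a → sumℤ n (λ i → F a i))
  sumℤ-comm zero    m F = sym (sumℤ-zero m (λ _ _ → refl))
  sumℤ-comm (suc n) m F = trans (cong (_+ sumℤ m (λ a → F a n)) (sumℤ-comm n m F))
                                (sym (sumℤ-+ m (λ a → sumℤ n (λ i → F a i)) (λ a → F a n)))

  sumℤ-sumℕ : ∀ n (f : ℕ → ℕ) → sumℤ n (+_ ∘ f) ≡ + sumℕ n f
  sumℤ-sumℕ zero    f = refl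
  sumℤ-sumℕ (suc n) f rewrite sumℤ-sumℕ n f = sym (pos-+ (sumℕ n f) (f n))

  sumℤ-reverse : ∀ n (f : ℕ → ℤ) → sumℤ (suc n) f ≡ sumℤ (suc n) (λ c → f (n ∸ c))
  sumℤ-reverse zero    f = refl
  sumℤ-reverse (suc n) f = trans (cong (_+ f (suc n)) (sumℤ-reverse n f))
    (trans (+-comm _ (f (suc n))) (sym (sumℤ-suc (suc n) (λ c → f (suc n ∸ c)))))

  infix  4 _≐_
  infixl 6 _⊕_ _⊖_

  _≐_ : Series → Series → Set
  F ≐ G = ∀ k i → F k i ≡ G k i

  _⊕_ _⊖_ : Series → Series → Series
  (F ⊕ G) k i = F k i + G k i
  (F ⊖ G) k i = F k i - G k i

  one : Series
  one zero zero = + 1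
  one _    _    = + 0

  mulX : (ℕ → ℤ) → ℕ → ℤ
  mulX f zero    = + 0
  mulX f (suc i) = f i

  shiftY shiftX : Series → Series
  shiftY F zero    i = + 0
  shiftY F (suc k) i = F k i
  shiftX F k         = mulX (F k)

  ⋆-reverse : ∀ F G k i →
    (F ⋆ G) k i ≡ sumℤ (suc k) (λ c → sumℤ (suc i) (λ d → F (k ∸ c) (i ∸ d) * G c d))
  ⋆-reverse F G k i = trans (sumℤ-reverse k _)
    (sumℤ-cong (suc k) (λ c c≤k → trans (sumℤ-reverse i _)
      (sumℤ-cong (suc i) (λ d d≤i → cong₂ (λ a b → F (k ∸ c) (i ∸ d) * G a b)
        (ℕ.m∸[m∸n]≡n (ℕ.≤-pred c≤k)) (ℕ.m∸[m∸n]≡n (ℕ.≤-pred d≤i))))))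

  ⋆-congʳ : ∀ F {G H} → G ≐ H → F ⋆ G ≐ F ⋆ H
  ⋆-congʳ F G≐H k i = sumℤ-cong (suc k) (λ a _ → sumℤ-cong (suc i) (λ b _ →
    cong (F a b *_) (G≐H (k ∸ a) (i ∸ b))))

  ⋆-⊕ʳ : ∀ F G H {G′ H′} → F ⋆ G ≐ G′ → F ⋆ H ≐ H′ → F ⋆ (G ⊕ H) ≐ G′ ⊕ H′
  ⋆-⊕ʳ F G H {G′} {H′} F⋆G≐G′ F⋆H≐H′ k i = begin
      (F ⋆ (G ⊕ H)) k i
    ≡⟨ sumℤ-cong (suc k) (λ a _ → trans (sumℤ-cong (suc i) (λ b _ → *-distribˡ-+ (F a b) _ _))
                                        (sumℤ-+ (suc i) _ _)) ⟩
      sumℤ (suc k) (λ a → sumℤ (suc i) (λ b → F a b * G (k ∸ a) (i ∸ b))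
                        + sumℤ (suc i) (λ b → F a b * H (k ∸ a) (i ∸ b)))
    ≡⟨ sumℤ-+ (suc k) _ _ ⟩
      (F ⋆ G) k i + (F ⋆ H) k i
    ≡⟨ cong₂ _+_ (F⋆G≐G′ k i) (F⋆H≐H′ k i) ⟩
      G′ k i + H′ k i
    ∎

  ⋆-negʳ : ∀ F G k i → (F ⋆ (λ k i → - G k i)) k i ≡ - (F ⋆ G) k i
  ⋆-negʳ F G k i = trans
    (sumℤ-cong (suc k) (λ a _ → trans (sumℤ-cong (suc i) (λ b _ → sym (neg-distribʳ-* (F a b) _)))
                                      (sumℤ-neg (suc i) _)))
    (sumℤ-neg (suc k) _)

  ⋆-⊖ʳ : ∀ F G H {G′ H′} → F ⋆ G ≐ G′ → F ⋆ H ≐ H′ → F ⋆ (G ⊖ H) ≐ G′ ⊖ H′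
  ⋆-⊖ʳ F G H F⋆G≐G′ F⋆H≐H′ =
    ⋆-⊕ʳ F G (λ k i → - H k i) F⋆G≐G′ (λ k i → trans (⋆-negʳ F H k i) (cong -_ (F⋆H≐H′ k i)))

  ⋆-oneʳ : ∀ F → F ⋆ one ≐ F
  ⋆-oneʳ F k i = begin
      (F ⋆ one) k i
    ≡⟨ ⋆-reverse F one k i ⟩
      sumℤ (suc k) (λ c → sumℤ (suc i) (λ d → F (k ∸ c) (i ∸ d) * one c d))
    ≡⟨ sumℤ-suc k _ ⟩
      sumℤ (suc i) (λ d → F k (i ∸ d) * one 0 d)
        + sumℤ k (λ c → sumℤ (suc i) (λ d → F (k ∸ suc c) (i ∸ d) * + 0))
    ≡⟨ cong₂ _+_ (sumℤ-suc i _)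
                 (sumℤ-zero k (λ c _ → sumℤ-zero (suc i) (λ d _ → *-zeroʳ (F (k ∸ suc c) (i ∸ d))))) ⟩
      F k i * + 1 + sumℤ i (λ d → F k (i ∸ suc d) * + 0) + + 0
    ≡⟨ cong (λ s → F k i * + 1 + s + + 0) (sumℤ-zero i (λ d _ → *-zeroʳ (F k (i ∸ suc d)))) ⟩
      F k i * + 1 + + 0 + + 0
    ≡⟨ trans (+-identityʳ _) (trans (+-identityʳ _) (*-identityʳ _)) ⟩
      F k i
    ∎

  ⋆-shiftYʳ : ∀ F G {H} → F ⋆ G ≐ H → F ⋆ shiftY G ≐ shiftY H
  ⋆-shiftYʳ F G {H} F⋆G≐H k i = begin
      (F ⋆ shiftY G) k i
    ≡⟨ ⋆-reverse F (shiftY G) k i ⟩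
      sumℤ (suc k) (λ c → sumℤ (suc i) (λ d → F (k ∸ c) (i ∸ d) * shiftY G c d))
    ≡⟨ sumℤ-suc k _ ⟩
      sumℤ (suc i) (λ d → F k (i ∸ d) * + 0) + sumℤ k (rows k)
    ≡⟨ cong (_+ sumℤ k (rows k)) (sumℤ-zero (suc i) (λ d _ → *-zeroʳ (F k (i ∸ d)))) ⟩
      + 0 + sumℤ k (rows k)
    ≡⟨ +-identityˡ _ ⟩
      sumℤ k (rows k)
    ≡⟨ lower k ⟩
      shiftY H k i
    ∎
    where
      rows : ℕ → ℕ → ℤ
      rows k c = sumℤ (suc i) (λ d → F (k ∸ suc c) (i ∸ d) * G c d)
      lower : ∀ k → sumℤ k (rows k) ≡ shiftY H k i
      lower zero    = refl
      lower (suc k) = trans (sym (⋆-reverse F G k i)) (F⋆G≐H k i)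

  ⋆-shiftXʳ : ∀ F G {H} → F ⋆ G ≐ H → F ⋆ shiftX G ≐ shiftX H
  ⋆-shiftXʳ F G {H} F⋆G≐H k i = begin
      (F ⋆ shiftX G) k i
    ≡⟨ ⋆-reverse F (shiftX G) k i ⟩
      sumℤ (suc k) (λ c → sumℤ (suc i) (λ d → F (k ∸ c) (i ∸ d) * shiftX G c d))
    ≡⟨ sumℤ-cong (suc k) (λ c _ → drop-first c) ⟩
      sumℤ (suc k) (λ c → sumℤ i (λ d → F (k ∸ c) (i ∸ suc d) * G c d))
    ≡⟨ lower i ⟩
      shiftX H k i
    ∎
    where
      drop-first : ∀ c → sumℤ (suc i) (λ d → F (k ∸ c) (i ∸ d) * shiftX G c d) ≡
                         sumℤ i (λ d → F (k ∸ c) (i ∸ suc d) * G c d)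
      drop-first c = trans (sumℤ-suc i _)
        (trans (cong (_+ sumℤ i (λ d → F (k ∸ c) (i ∸ suc d) * G c d)) (*-zeroʳ (F (k ∸ c) i)))
               (+-identityˡ _))
      lower : ∀ i → sumℤ (suc k) (λ c → sumℤ i (λ d → F (k ∸ c) (i ∸ suc d) * G c d)) ≡ shiftX H k i
      lower zero    = sumℤ-zero (suc k) (λ _ _ → refl)
      lower (suc i) = trans (sym (⋆-reverse F G k i)) (F⋆G≐H k i)

  -- (1 − y)(1 + (1 − x) y + y²) = 1 − x y + x y² − y³
  denominator : Series
  denominator = one ⊖ shiftX (shiftY one) ⊕ shiftX (shiftY (shiftY one)) ⊖ shiftY (shiftY (shiftY one))

  quadFactor-monomials : quadFactor ≐ one ⊕ shiftY one ⊖ shiftX (shiftY one) ⊕ shiftY (shiftY one)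
  quadFactor-monomials 0                   0                   = refl
  quadFactor-monomials 0                   (suc i)             = refl
  quadFactor-monomials 1                   0                   = refl
  quadFactor-monomials 1                   1                   = refl
  quadFactor-monomials 1                   (suc (suc i))       = refl
  quadFactor-monomials 2                   0                   = refl
  quadFactor-monomials 2                   (suc i)             = refl
  quadFactor-monomials (suc (suc (suc k))) 0                   = refl
  quadFactor-monomials (suc (suc (suc k))) (suc i)             = refl

  expanded-denominator :
    oneMinusY ⊕ shiftY oneMinusY ⊖ shiftX (shiftY oneMinusY) ⊕ shiftY (shiftY oneMinusY) ≐ denominator
  expanded-denominator 0                         0             = refl
  expanded-denominator 0                         (suc i)       = refl
  expanded-denominator 1                         0             = refl
  expanded-denominator 1                         1             = refl
  expanded-denominator 1                         (suc (suc i)) = refl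
  expanded-denominator 2                         0             = refl
  expanded-denominator 2                         1             = refl
  expanded-denominator 2                         (suc (suc i)) = refl
  expanded-denominator 3                         0             = refl
  expanded-denominator 3                         (suc i)       = refl
  expanded-denominator (suc (suc (suc (suc k)))) 0             = refl
  expanded-denominator (suc (suc (suc (suc k)))) (suc i)       = refl

  product-denominator : oneMinusY ⋆ quadFactor ≐ denominator
  product-denominator k i = begin
      (oneMinusY ⋆ quadFactor) k i
    ≡⟨ ⋆-congʳ F quadFactor-monomials k i ⟩
      (F ⋆ (one ⊕ y ⊖ shiftX y ⊕ shiftY y)) k i
    ≡⟨ ⋆-⊕ʳ F (one ⊕ y ⊖ shiftX y) (shiftY y)
         (⋆-⊖ʳ F (one ⊕ y) (shiftX y) (⋆-⊕ʳ F one y F⋆one (F⋆y)) (⋆-shiftXʳ F y F⋆y))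
         (⋆-shiftYʳ F y F⋆y) k i ⟩
      (F ⊕ shiftY F ⊖ shiftX (shiftY F) ⊕ shiftY (shiftY F)) k i
    ≡⟨ expanded-denominator k i ⟩
      denominator k i
    ∎
    where
      F = oneMinusY
      y = shiftY one
      F⋆one = ⋆-oneʳ F
      F⋆y = ⋆-shiftYʳ F one F⋆one

  ⋆-denominator : ∀ F →
    F ⋆ denominator ≐ F ⊖ shiftX (shiftY F) ⊕ shiftX (shiftY (shiftY F)) ⊖ shiftY (shiftY (shiftY F))
  ⋆-denominator F =
    ⋆-⊖ʳ F (one ⊖ shiftX y ⊕ shiftX (shiftY y)) (shiftY (shiftY y))
      (⋆-⊕ʳ F (one ⊖ shiftX y) (shiftX (shiftY y))
        (⋆-⊖ʳ F one (shiftX y) F⋆one (⋆-shiftXʳ F y F⋆y))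
        (⋆-shiftXʳ F (shiftY y) F⋆y²))
      (⋆-shiftYʳ F (shiftY y) F⋆y²)
    where
      y = shiftY one
      F⋆one = ⋆-oneʳ F
      F⋆y = ⋆-shiftYʳ F one F⋆one
      F⋆y² = ⋆-shiftYʳ F y F⋆y

  rStep : Series → Series
  rStep F = seriesY ⊕ shiftX (shiftY F) ⊖ shiftX (shiftY (shiftY F)) ⊕ shiftY (shiftY (shiftY F))

  IsRGenFun⇒fixed : ∀ r → IsRGenFun r → r ≐ rStep r
  IsRGenFun⇒fixed r r⋆E≐y k i =
    trans (solve (r k i) (xyr k i) (xy²r k i) (y³r k i))
          (cong (λ s → s + xyr k i - xy²r k i + y³r k i) r⋆denominator)
    where
      xyr  = shiftX (shiftY r)
      xy²r = shiftX (shiftY (shiftY r))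
      y³r  = shiftY (shiftY (shiftY r))
      r⋆denominator : r k i - xyr k i + xy²r k i - y³r k i ≡ seriesY k i
      r⋆denominator = trans (sym (trans (⋆-congʳ r product-denominator k i) (⋆-denominator r k i)))
                            (r⋆E≐y k i)
      solve : ∀ a b c d → a ≡ (a - b + c - d) + b - c + d
      solve = solve-∀

  AgreeBelow : Series → Series → ℕ → Set
  AgreeBelow F G k = ∀ {k′} → k′ < k → ∀ i → F k′ i ≡ G k′ i

  shiftY-row : ∀ {F G k} → AgreeBelow F G k → ∀ i → shiftY F k i ≡ shiftY G k i
  shiftY-row {k = zero}  below i = refl
  shiftY-row {k = suc k} below i = below (ℕ.n<1+n k) i

  shiftY-below : ∀ {F G k} → AgreeBelow F G k → AgreeBelow (shiftY F) (shiftY G) k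
  shiftY-below below {zero}   k′<k i = refl
  shiftY-below below {suc k′} k′<k i = below (ℕ.<-trans (ℕ.n<1+n k′) k′<k) i

  mulX-cong : ∀ {f g} → (∀ i → f i ≡ g i) → ∀ i → mulX f i ≡ mulX g i
  mulX-cong f≗g zero    = refl
  mulX-cong f≗g (suc i) = f≗g i

  rStep-row : ∀ {F G k} → AgreeBelow F G k → ∀ i → rStep F k i ≡ rStep G k i
  rStep-row {k = k} below i =
    cong₂ _+_ (cong₂ _-_ (cong (λ x → seriesY k i + x) (mulX-cong (shiftY-row below) i))
                         (mulX-cong (shiftY-row (shiftY-below below)) i))
              (shiftY-row (shiftY-below (shiftY-below below)) i)

  rStep-unique : ∀ {F G} → F ≐ rStep F → G ≐ rStep G → F ≐ G
  rStep-unique {F} {G} F≐ G≐ = <-rec (λ k → ∀ i → F k i ≡ G k i)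
    (λ k below i → trans (F≐ k i) (trans (rStep-row below i) (sym (G≐ k i))))

  -- [xⁱ yᵃ] 1 / (1 + (1 − x) y + y²)
  quadInverse : ℕ → ℕ → ℤ
  quadInverse 0             0       = + 1
  quadInverse 0             (suc i) = + 0
  quadInverse 1             i       = mulX (quadInverse 0) i - quadInverse 0 i
  quadInverse (suc (suc a)) i       = mulX (quadInverse (suc a)) i - quadInverse (suc a) i - quadInverse a i

  -- [xⁱ yᵏ] y / ((1 − y)(1 + (1 − x) y + y²))
  rSolution : Series
  rSolution k i = sumℤ k (λ a → quadInverse a i)

  rSolution-fixed : rSolution ≐ rStep rSolution
  rSolution-fixed 0                   0             = refl
  rSolution-fixed 0                   (suc i)       = refl
  rSolution-fixed 1                   0             = refl
  rSolution-fixed 1                   (suc i)       = refl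
  rSolution-fixed 2                   0             = refl
  rSolution-fixed 2                   1             = refl
  rSolution-fixed 2                   (suc (suc i)) = refl
  rSolution-fixed (suc (suc (suc k))) 0             =
    solve (rSolution k 0) (quadInverse k 0) (quadInverse (suc k) 0)
    where solve : ∀ R Q₀ Q₁ → R + Q₀ + Q₁ + (+ 0 - Q₁ - Q₀) ≡ + 0 + + 0 - + 0 + R
          solve = solve-∀
  rSolution-fixed (suc (suc (suc k))) (suc i)       =
    solve (rSolution k (suc i)) (quadInverse k (suc i)) (quadInverse (suc k) (suc i))
          (quadInverse (suc k) i) (rSolution k i) (quadInverse k i)
    where solve : ∀ R Q₀ Q₁ X R′ Q₀′ →
                  R + Q₀ + Q₁ + (X - Q₁ - Q₀) ≡ + 0 + (R′ + Q₀′ + X) - (R′ + Q₀′) + R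
          solve = solve-∀

  motzkinAt : ℕ → ℕ → ℤ
  motzkinAt N i = + motzkinPaths (i ℕ.+ N) 0

  -- Evaluating xⁱ at M_{i+N} sends Q_a to the number of Motzkin paths of length N at height a:
  -- multiplication by x lengthens the paths by one step, matching Q_{a+2} = (x − 1) Q_{a+1} − Q_a.
  quadInverse-motzkinPaths : ∀ a N K → a < K →
    sumℤ K (λ i → quadInverse a i * motzkinAt N i) ≡ + motzkinPaths N a
  quadInverse-motzkinPaths 0 N (suc K) _ = begin
      sumℤ (suc K) (λ i → quadInverse 0 i * motzkinAt N i)
    ≡⟨ sumℤ-suc K _ ⟩
      + 1 * motzkinAt N 0 + sumℤ K (λ i → + 0 * motzkinAt N (suc i))
    ≡⟨ cong (λ s → + 1 * motzkinAt N 0 + s) (sumℤ-zero K (λ i _ → *-zeroˡ (motzkinAt N (suc i)))) ⟩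
      + 1 * motzkinAt N 0 + + 0
    ≡⟨ trans (+-identityʳ _) (*-identityˡ _) ⟩
      + motzkinPaths N 0
    ∎
  quadInverse-motzkinPaths 1 N 1 (s≤s ())
  quadInverse-motzkinPaths 1 N (suc (suc K)) _ = begin
      sumℤ (suc (suc K)) (λ i → quadInverse 1 i * motzkinAt N i)
    ≡⟨ trans (sumℤ-suc (suc K) _) (cong (λ s → - + 1 * motzkinAt N 0 + s) (sumℤ-suc K _)) ⟩
      - + 1 * motzkinAt N 0 + (+ 1 * motzkinAt N 1 + sumℤ K (λ i → + 0 * motzkinAt N (suc (suc i))))
    ≡⟨ cong (λ s → - + 1 * motzkinAt N 0 + (+ 1 * motzkinAt N 1 + s))
            (sumℤ-zero K (λ i _ → *-zeroˡ (motzkinAt N (suc (suc i))))) ⟩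
      - + 1 * motzkinAt N 0 + (+ 1 * motzkinAt N 1 + + 0)
    ≡⟨ cong (λ s → - + 1 * motzkinAt N 0 + (+ 1 * s + + 0))
            (trans (pos-+ (motzkinPaths N 1 ℕ.+ motzkinPaths N 0) 0)
                   (cong (_+ + 0) (pos-+ (motzkinPaths N 1) (motzkinPaths N 0)))) ⟩
      - + 1 * motzkinAt N 0 + (+ 1 * (+ motzkinPaths N 1 + motzkinAt N 0 + + 0) + + 0)
    ≡⟨ solve (+ motzkinPaths N 1) (motzkinAt N 0) ⟩
      + motzkinPaths N 1
    ∎
    where solve : ∀ x y → - + 1 * y + (+ 1 * (x + y + + 0) + + 0) ≡ x
          solve = solve-∀
  quadInverse-motzkinPaths (suc (suc a)) N (suc K) (s≤s a+1<K) = begin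
      sumℤ (suc K) (λ i → quadInverse (suc (suc a)) i * motzkinAt N i)
    ≡⟨ sumℤ-cong (suc K) (λ i _ → distrib (mulX (Q₁) i) (Q₁ i) (Q₀ i) (motzkinAt N i)) ⟩
      sumℤ (suc K) (λ i → (mulX Q₁ i * motzkinAt N i + - (Q₁ i * motzkinAt N i)) + - (Q₀ i * motzkinAt N i))
    ≡⟨ trans (sumℤ-+ (suc K) _ _) (cong₂ _+_ (sumℤ-+ (suc K) _ _) (sumℤ-neg (suc K) _)) ⟩
      sumℤ (suc K) (λ i → mulX Q₁ i * motzkinAt N i) + sumℤ (suc K) (λ i → - (Q₁ i * motzkinAt N i))
        + - sumℤ (suc K) (λ i → Q₀ i * motzkinAt N i)
    ≡⟨ cong₂ (λ x y → x + y + - sumℤ (suc K) (λ i → Q₀ i * motzkinAt N i)) shifted (sumℤ-neg (suc K) _) ⟩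
      + motzkinPaths (suc N) (suc a) + - sumℤ (suc K) (λ i → Q₁ i * motzkinAt N i)
        + - sumℤ (suc K) (λ i → Q₀ i * motzkinAt N i)
    ≡⟨ cong₂ (λ x y → + motzkinPaths (suc N) (suc a) + - x + - y)
             (quadInverse-motzkinPaths (suc a) N (suc K) (ℕ.m<n⇒m<1+n a+1<K))
             (quadInverse-motzkinPaths a N (suc K) (ℕ.m<n⇒m<1+n (ℕ.<-trans (ℕ.n<1+n a) a+1<K))) ⟩
      + motzkinPaths (suc N) (suc a) + - + motzkinPaths N (suc a) + - + motzkinPaths N a
    ≡⟨ cong (λ z → z + - + motzkinPaths N (suc a) + - + motzkinPaths N a)
            (trans (pos-+ (motzkinPaths N (suc (suc a)) ℕ.+ motzkinPaths N (suc a)) (motzkinPaths N a))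
                   (cong (_+ + motzkinPaths N a) (pos-+ (motzkinPaths N (suc (suc a))) (motzkinPaths N (suc a))))) ⟩
      + motzkinPaths N (suc (suc a)) + + motzkinPaths N (suc a) + + motzkinPaths N a
        + - + motzkinPaths N (suc a) + - + motzkinPaths N a
    ≡⟨ cancel (+ motzkinPaths N (suc (suc a))) (+ motzkinPaths N (suc a)) (+ motzkinPaths N a) ⟩
      + motzkinPaths N (suc (suc a))
    ∎
    where
      Q₁ = quadInverse (suc a)
      Q₀ = quadInverse a
      distrib : ∀ s q p m → (s - q - p) * m ≡ (s * m + - (q * m)) + - (p * m)
      distrib = solve-∀
      cancel : ∀ x y z → x + y + z + - y + - z ≡ x
      cancel = solve-∀
      shifted : sumℤ (suc K) (λ i → mulX Q₁ i * motzkinAt N i) ≡ + motzkinPaths (suc N) (suc a)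
      shifted = trans (sumℤ-suc K _) (trans (+-identityˡ _)
        (trans (sumℤ-cong K (λ i _ → cong (λ n → Q₁ i * + motzkinPaths n 0) (sym (ℕ.+-suc i N))))
               (quadInverse-motzkinPaths (suc a) (suc N) K a+1<K)))

  rSolution-motzkinPaths : ∀ k N → sumℤ k (λ i → rSolution k i * motzkinAt N i) ≡ + sumℕ k (motzkinPaths N)
  rSolution-motzkinPaths k N = begin
      sumℤ k (λ i → rSolution k i * motzkinAt N i)
    ≡⟨ sumℤ-cong k (λ i _ → sym (sumℤ-*ʳ k (λ a → quadInverse a i) (motzkinAt N i))) ⟩
      sumℤ k (λ i → sumℤ k (λ a → quadInverse a i * motzkinAt N i))
    ≡⟨ sumℤ-comm k k (λ a i → quadInverse a i * motzkinAt N i) ⟩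
      sumℤ k (λ a → sumℤ k (λ i → quadInverse a i * motzkinAt N i))
    ≡⟨ sumℤ-cong k (λ a a<k → quadInverse-motzkinPaths a N k a<k) ⟩
      sumℤ k (λ a → + motzkinPaths N a)
    ≡⟨ sumℤ-sumℕ k (motzkinPaths N) ⟩
      + sumℕ k (motzkinPaths N)
    ∎

  IsRGenFun-motzkin : ∀ r → IsRGenFun r → ∀ k N →
    sumℤ k (λ i → r k i * + motzkin (i ℕ.+ N)) ≡ + sumℕ k (motzkinPaths N)
  IsRGenFun-motzkin r r⋆E≐y k N =
    trans (sumℤ-cong k (λ i _ → cong₂ (λ c m → c * + m) (r≐rSolution k i) (motzkin-motzkinPaths (i ℕ.+ N))))
          (rSolution-motzkinPaths k N)
    where r≐rSolution = rStep-unique (IsRGenFun⇒fixed r r⋆E≐y) rSolution-fixed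


module StandardRows where
  open import Data.Nat
  open import Data.Nat.Properties
  open import Data.List using (List; []; _∷_; _++_; _∷ʳ_; length; map; upTo; concatMap; _∷ʳ′_; initLast)
  open import Data.List.Properties using (++-assoc; map-++; upTo-∷ʳ; ∷ʳ-injectiveˡ; length-++)
  open import Data.List.Membership.Propositional using (_∈_; find; lose)
  open import Data.List.Membership.Propositional.Properties
    using (∈-++⁺ˡ; ∈-++⁺ʳ; ∈-++⁻; ∈-map⁻; ∈-upTo⁻; ∈-concatMap⁺; ∈-concatMap⁻)
  open import Data.List.Relation.Unary.Any using (here; there)
  open import Data.List.Relation.Unary.All as All using (All; []; _∷_)
  open import Data.List.Relation.Unary.AllPairs using ([]; _∷_)
  open import Data.List.Relation.Unary.Unique.Propositional using (Unique)
  import Data.List.Relation.Unary.Unique.Propositional.Properties as Unique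
  open import Data.List.Relation.Binary.Permutation.Propositional using (_↭_; ↭-sym; ↭-trans; ↭-refl; prep)
  open import Data.List.Relation.Binary.Permutation.Propositional.Properties
    using (∈-resp-↭; ↭-length; ++⁺ˡ; shift; drop-∷; ∷↭∷ʳ)
  open import Data.Product using (∃; _×_; _,_; proj₁; proj₂)
  open import Data.Sum using (_⊎_; inj₁; inj₂)
  open import Data.Empty using (⊥; ⊥-elim)
  open import Data.Unit using (⊤; tt)
  open import Relation.Nullary using (Dec; yes; no)
  open import Relation.Binary.PropositionalEquality
  open import Defs using (nth; oneTo)

  length-∷ʳ : ∀ (R : List ℕ) x → length (R ∷ʳ x) ≡ suc (length R)
  length-∷ʳ []      x = refl
  length-∷ʳ (y ∷ R) x = cong suc (length-∷ʳ R x)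

  nth-∷ʳ-< : ∀ (R : List ℕ) x {j} → j < length R → nth (R ∷ʳ x) j ≡ nth R j
  nth-∷ʳ-< (y ∷ R) x {zero}  _         = refl
  nth-∷ʳ-< (y ∷ R) x {suc j} (s≤s j<n) = nth-∷ʳ-< R x j<n

  nth-∷ʳ-length : ∀ (R : List ℕ) x → nth (R ∷ʳ x) (length R) ≡ x
  nth-∷ʳ-length []      x = refl
  nth-∷ʳ-length (y ∷ R) x = nth-∷ʳ-length R x

  nth-∷ʳ : ∀ (R : List ℕ) x {j} → j < length (R ∷ʳ x) →
    j < length R × nth (R ∷ʳ x) j ≡ nth R j ⊎ j ≡ length R × nth (R ∷ʳ x) j ≡ x
  nth-∷ʳ R x {j} j<n with m≤n⇒m<n∨m≡n (≤-pred (subst (suc j ≤_) (length-∷ʳ R x) j<n))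
  ... | inj₁ j<len = inj₁ (j<len , nth-∷ʳ-< R x j<len)
  ... | inj₂ refl  = inj₂ (refl , nth-∷ʳ-length R x)

  nth-∈ : ∀ (R : List ℕ) {j} → j < length R → nth R j ∈ R
  nth-∈ (y ∷ R) {zero}  _         = here refl
  nth-∈ (y ∷ R) {suc j} (s≤s j<n) = there (nth-∈ R j<n)

  ∈⇒nth : ∀ {y} (R : List ℕ) → y ∈ R → ∃ λ j → j < length R × nth R j ≡ y
  ∈⇒nth (z ∷ R) (here refl) = 0 , s≤s z≤n , refl
  ∈⇒nth (z ∷ R) (there y∈R) with ∈⇒nth R y∈R
  ... | j , j<n , eq = suc j , s≤s j<n , eq

  ∈-∷ʳ : ∀ (R : List ℕ) x → x ∈ R ∷ʳ x
  ∈-∷ʳ R x = ∈-++⁺ʳ R (here refl)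

  oneTo-suc : ∀ N → oneTo (suc N) ≡ oneTo N ∷ʳ suc N
  oneTo-suc N = trans (cong (map suc) (sym (upTo-∷ʳ N))) (map-++ suc (upTo N) (N ∷ []))

  ∈-oneTo⇒≤ : ∀ {y} N → y ∈ oneTo N → y ≤ N
  ∈-oneTo⇒≤ N y∈ with ∈-map⁻ suc y∈
  ... | z , z∈ , refl = ∈-upTo⁻ z∈

  Unique-concatMap⁺ : ∀ {A B : Set} (f : A → List B) (P : A → Set) xs → Unique xs → All P xs →
    (∀ x → P x → Unique (f x)) → (∀ x y → P x → P y → ∀ z → z ∈ f x → z ∈ f y → x ≡ y) →
    Unique (concatMap f xs)
  Unique-concatMap⁺ f P []       _            _          _      _     = []
  Unique-concatMap⁺ f P (x ∷ xs) (x∉xs ∷ uxs) (px ∷ pxs) unique-f disjoint =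
    Unique.++⁺ (unique-f x px) (Unique-concatMap⁺ f P xs uxs pxs unique-f disjoint) separate
    where
      separate : ∀ {z} → z ∈ f x × z ∈ concatMap f xs → ⊥
      separate (z∈fx , z∈rest) with find (∈-concatMap⁻ f z∈rest)
      ... | y , y∈xs , z∈fy = All.lookup x∉xs y∈xs (disjoint x y px (All.lookup pxs y∈xs) _ z∈fx z∈fy)

  Rows : Set
  Rows = List ℕ × List ℕ × List ℕ

  entries : Rows → List ℕ
  entries (R₀ , R₁ , R₂) = R₀ ++ R₁ ++ R₂

  Increasing : List ℕ → Set
  Increasing R = ∀ j → suc j < length R → nth R j < nth R (suc j)

  -- R₀, R₁, R₂ fill the rows of the skew shape (u + |R₀|, |R₁|, |R₂|) / (u) with 1, …, N;
  -- the box in column j of R₁ lies below the box in column j − u of R₀.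
  record Standard (u N : ℕ) (R₀ R₁ R₂ : List ℕ) : Set where
    field
      shape₁ : length R₁ ≤ u + length R₀
      shape₂ : length R₂ ≤ length R₁
      perm   : R₀ ++ R₁ ++ R₂ ↭ oneTo N
      incr₀  : Increasing R₀
      incr₁  : Increasing R₁
      incr₂  : Increasing R₂
      col₀₁  : ∀ j → u ≤ j → j < length R₁ → nth R₀ (j ∸ u) < nth R₁ j
      col₁₂  : ∀ j → j < length R₂ → nth R₁ j < nth R₂ j

  IsStandard : ℕ → ℕ → Rows → Set
  IsStandard u N (R₀ , R₁ , R₂) = Standard u N R₀ R₁ R₂

  module _ {u N R₀ R₁ R₂} (std : Standard u N R₀ R₁ R₂) where
    open Standard std

    entry≤ : ∀ {y} → y ∈ R₀ ++ R₁ ++ R₂ → y ≤ N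
    entry≤ y∈ = ∈-oneTo⇒≤ N (∈-resp-↭ perm y∈)

    entry≤₀ : ∀ {y} → y ∈ R₀ → y ≤ N
    entry≤₀ y∈ = entry≤ (∈-++⁺ˡ y∈)

    entry≤₁ : ∀ {y} → y ∈ R₁ → y ≤ N
    entry≤₁ y∈ = entry≤ (∈-++⁺ʳ R₀ (∈-++⁺ˡ y∈))

    entry≤₂ : ∀ {y} → y ∈ R₂ → y ≤ N
    entry≤₂ y∈ = entry≤ (∈-++⁺ʳ R₀ (∈-++⁺ʳ R₁ y∈))

  largest∈ : ∀ {u N R₀ R₁ R₂} → Standard u (suc N) R₀ R₁ R₂ → suc N ∈ R₀ ++ R₁ ++ R₂
  largest∈ {N = N} std =
    ∈-resp-↭ (↭-sym (Standard.perm std)) (subst (suc N ∈_) (sym (oneTo-suc N)) (∈-∷ʳ (oneTo N) (suc N)))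

  data RowIx : Set where
    r₀ r₁ r₂ : RowIx

  append : RowIx → ℕ → Rows → Rows
  append r₀ x (R₀ , R₁ , R₂) = (R₀ ∷ʳ x , R₁ , R₂)
  append r₁ x (R₀ , R₁ , R₂) = (R₀ , R₁ ∷ʳ x , R₂)
  append r₂ x (R₀ , R₁ , R₂) = (R₀ , R₁ , R₂ ∷ʳ x)

  -- Appending to row i keeps the shape a partition.
  Addable : ℕ → RowIx → Rows → Set
  Addable u r₀ _              = ⊤
  Addable u r₁ (R₀ , R₁ , R₂) = length R₁ < u + length R₀
  Addable u r₂ (R₀ , R₁ , R₂) = length R₂ < length R₁

  optional : ∀ {P : Set} → Dec P → Rows → List Rows
  optional (yes _) t = t ∷ []
  optional (no  _) t = []

  extensions : ℕ → ℕ → Rows → List Rows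
  extensions u N s@(R₀ , R₁ , R₂) =
    append r₀ (suc N) s ∷ (optional (length R₁ <? u + length R₀) (append r₁ (suc N) s) ++
                           optional (length R₂ <? length R₁) (append r₂ (suc N) s))

  standardRows : ℕ → ℕ → List Rows
  standardRows u zero    = ([] , [] , []) ∷ []
  standardRows u (suc N) = concatMap (extensions u N) (standardRows u N)

  j∸u<n : ∀ {u j n} → u ≤ j → j < u + n → j ∸ u < n
  j∸u<n {u} {j} {n} u≤j j<u+n = +-cancelˡ-< u (j ∸ u) n (subst (_< u + n) (sym (m+[n∸m]≡n u≤j)) j<u+n)

  Increasing-∷ʳ : ∀ (R : List ℕ) N → Increasing R → (∀ {y} → y ∈ R → y ≤ N) →
                  Increasing (R ∷ʳ suc N)
  Increasing-∷ʳ R N incr R≤N j j+1<n with nth-∷ʳ R (suc N) j+1<n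
  ... | inj₁ (j+1<len , eq) =
    subst₂ _<_ (sym (nth-∷ʳ-< R (suc N) (<-trans (n<1+n j) j+1<len))) (sym eq) (incr j j+1<len)
  ... | inj₂ (j+1≡len , eq) = subst₂ _<_ (sym (nth-∷ʳ-< R (suc N) j<len)) (sym eq) (s≤s (R≤N (nth-∈ R j<len)))
    where j<len = subst (j <_) j+1≡len (n<1+n j)

  Increasing-∷ʳ⁻ : ∀ (R : List ℕ) x → Increasing (R ∷ʳ x) → Increasing R
  Increasing-∷ʳ⁻ R x incr j j+1<n =
    subst₂ _<_ (nth-∷ʳ-< R x (<-trans (n<1+n j) j+1<n)) (nth-∷ʳ-< R x j+1<n)
               (incr j (subst (suc (suc j) ≤_) (sym (length-∷ʳ R x)) (m<n⇒m<1+n j+1<n)))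

  entries-append : ∀ i x s → entries (append i x s) ↭ x ∷ entries s
  entries-append r₀ x (R₀ , R₁ , R₂) =
    subst (_↭ x ∷ R₀ ++ R₁ ++ R₂) (sym (++-assoc R₀ (x ∷ []) (R₁ ++ R₂))) (shift x R₀ (R₁ ++ R₂))
  entries-append r₁ x (R₀ , R₁ , R₂) =
    subst (_↭ x ∷ R₀ ++ R₁ ++ R₂) (sym (cong (R₀ ++_) (++-assoc R₁ (x ∷ []) R₂)))
          (↭-trans (++⁺ˡ R₀ (shift x R₁ R₂)) (shift x R₀ (R₁ ++ R₂)))
  entries-append r₂ x (R₀ , R₁ , R₂) =
    subst (_↭ x ∷ R₀ ++ R₁ ++ R₂)
          (trans (++-assoc R₀ (R₁ ++ R₂) (x ∷ [])) (cong (R₀ ++_) (++-assoc R₁ R₂ (x ∷ []))))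
          (↭-sym (∷↭∷ʳ x (R₀ ++ R₁ ++ R₂)))

  append-perm : ∀ i N s → entries s ↭ oneTo N → entries (append i (suc N) s) ↭ oneTo (suc N)
  append-perm i N s perm = subst (entries (append i (suc N) s) ↭_) (sym (oneTo-suc N))
    (↭-trans (entries-append i (suc N) s) (↭-trans (prep (suc N) perm) (∷↭∷ʳ (suc N) (oneTo N))))

  append-perm⁻ : ∀ i N s → entries (append i (suc N) s) ↭ oneTo (suc N) → entries s ↭ oneTo N
  append-perm⁻ i N s perm = drop-∷ (↭-trans (↭-sym (entries-append i (suc N) s))
    (↭-trans perm (subst (_↭ suc N ∷ oneTo N) (sym (oneTo-suc N)) (↭-sym (∷↭∷ʳ (suc N) (oneTo N))))))

  -- The new entry N + 1 exceeds every old entry, in particular those above and to the left of it.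
  append-standard : ∀ {u N} i s → IsStandard u N s → Addable u i s → IsStandard u (suc N) (append i (suc N) s)
  append-standard {u} {N} r₀ s@(R₀ , R₁ , R₂) std _ = record
    { shape₁ = ≤-trans shape₁ (+-monoʳ-≤ u (subst (length R₀ ≤_) (sym (length-∷ʳ R₀ (suc N))) (n≤1+n _)))
    ; shape₂ = shape₂
    ; perm   = append-perm r₀ N s perm
    ; incr₀  = Increasing-∷ʳ R₀ N incr₀ (entry≤₀ std)
    ; incr₁  = incr₁
    ; incr₂  = incr₂
    ; col₀₁  = λ j u≤j j<n → subst (_< nth R₁ j)
                 (sym (nth-∷ʳ-< R₀ (suc N) (j∸u<n u≤j (<-≤-trans j<n shape₁)))) (col₀₁ j u≤j j<n)
    ; col₁₂  = col₁₂
    }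
    where open Standard std
  append-standard {u} {N} r₁ s@(R₀ , R₁ , R₂) std addable = record
    { shape₁ = subst (_≤ u + length R₀) (sym (length-∷ʳ R₁ (suc N))) addable
    ; shape₂ = ≤-trans shape₂ (subst (length R₁ ≤_) (sym (length-∷ʳ R₁ (suc N))) (n≤1+n _))
    ; perm   = append-perm r₁ N s perm
    ; incr₀  = incr₀
    ; incr₁  = Increasing-∷ʳ R₁ N incr₁ (entry≤₁ std)
    ; incr₂  = incr₂
    ; col₀₁  = col₀₁′
    ; col₁₂  = λ j j<n → subst (_< nth R₂ j)
                 (sym (nth-∷ʳ-< R₁ (suc N) (<-≤-trans j<n shape₂))) (col₁₂ j j<n)
    }
    where
      open Standard std
      col₀₁′ : ∀ j → u ≤ j → j < length (R₁ ∷ʳ suc N) → nth R₀ (j ∸ u) < nth (R₁ ∷ʳ suc N) j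
      col₀₁′ j u≤j j<n with nth-∷ʳ R₁ (suc N) j<n
      ... | inj₁ (j<len , eq) = subst (nth R₀ (j ∸ u) <_) (sym eq) (col₀₁ j u≤j j<len)
      ... | inj₂ (refl  , eq) =
        subst (nth R₀ (j ∸ u) <_) (sym eq) (s≤s (entry≤₀ std (nth-∈ R₀ (j∸u<n u≤j addable))))
  append-standard {u} {N} r₂ s@(R₀ , R₁ , R₂) std addable = record
    { shape₁ = shape₁
    ; shape₂ = subst (_≤ length R₁) (sym (length-∷ʳ R₂ (suc N))) addable
    ; perm   = append-perm r₂ N s perm
    ; incr₀  = incr₀
    ; incr₁  = incr₁
    ; incr₂  = Increasing-∷ʳ R₂ N incr₂ (entry≤₂ std)
    ; col₀₁  = col₀₁
    ; col₁₂  = col₁₂′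
    }
    where
      open Standard std
      col₁₂′ : ∀ j → j < length (R₂ ∷ʳ suc N) → nth R₁ j < nth (R₂ ∷ʳ suc N) j
      col₁₂′ j j<n with nth-∷ʳ R₂ (suc N) j<n
      ... | inj₁ (j<len , eq) = subst (nth R₁ j <_) (sym eq) (col₁₂ j j<len)
      ... | inj₂ (refl  , eq) = subst (nth R₁ (length R₂) <_) (sym eq) (s≤s (entry≤₁ std (nth-∈ R₁ addable)))

  max-last : ∀ (R : List ℕ) x → Increasing R → (∀ {y} → y ∈ R → y ≤ x) → x ∈ R →
             ∃ λ R′ → R ≡ R′ ∷ʳ x
  max-last R x incr R≤x x∈R with initLast R
  max-last .[]        x incr R≤x () | []
  max-last .(R′ ∷ʳ y) x incr R≤x x∈R | R′ ∷ʳ′ y with ∈⇒nth (R′ ∷ʳ y) x∈R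
  ... | j , j<n , nth-j≡x with nth-∷ʳ R′ y j<n
  ... | inj₁ (j<len , _) = ⊥-elim (<-irrefl refl
          (<-≤-trans (subst (_< nth (R′ ∷ʳ y) (suc j)) nth-j≡x (incr j j+1<n)) (R≤x (nth-∈ (R′ ∷ʳ y) j+1<n))))
    where j+1<n = subst (suc j <_) (sym (length-∷ʳ R′ y)) (s≤s j<len)
  ... | inj₂ (_ , eq)    = R′ , cong (R′ ∷ʳ_) (trans (sym eq) nth-j≡x)

  Removal : ℕ → ℕ → Rows → Set
  Removal u N t = ∃ λ i → ∃ λ s → IsStandard u N s × Addable u i s × t ≡ append i (suc N) s

  remove-from-R₀ : ∀ {u N R₀ R₁ R₂} → Standard u (suc N) R₀ R₁ R₂ → suc N ∈ R₀ →
                   Removal u N (R₀ , R₁ , R₂)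
  remove-from-R₀ {u} {N} {R₀} {R₁} {R₂} std N+1∈ with max-last R₀ (suc N) incr₀ (entry≤₀ std) N+1∈
    where open Standard std
  ... | R₀′ , refl = r₀ , (R₀′ , R₁ , R₂) , std′ , tt , refl
    where
      open Standard std
      shape₁′ : length R₁ ≤ u + length R₀′
      shape₁′ with length R₁ ≤? u + length R₀′
      ... | yes ≤ = ≤
      ... | no  ≰ = ⊥-elim (<-irrefl refl (<-≤-trans below (entry≤₁ std (nth-∈ R₁ j<len))))
        where
          j<len = ≰⇒> ≰
          below : suc N < nth R₁ (u + length R₀′)
          below = subst (_< nth R₁ (u + length R₀′))
                    (trans (cong (nth (R₀′ ∷ʳ suc N)) (m+n∸m≡n u (length R₀′))) (nth-∷ʳ-length R₀′ (suc N)))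
                    (col₀₁ (u + length R₀′) (m≤m+n u (length R₀′)) j<len)
      std′ : Standard u N R₀′ R₁ R₂
      std′ = record
        { shape₁ = shape₁′
        ; shape₂ = shape₂
        ; perm   = append-perm⁻ r₀ N (R₀′ , R₁ , R₂) perm
        ; incr₀  = Increasing-∷ʳ⁻ R₀′ (suc N) incr₀
        ; incr₁  = incr₁
        ; incr₂  = incr₂
        ; col₀₁  = λ j u≤j j<n → subst (_< nth R₁ j)
                     (nth-∷ʳ-< R₀′ (suc N) (j∸u<n u≤j (<-≤-trans j<n shape₁′))) (col₀₁ j u≤j j<n)
        ; col₁₂  = col₁₂
        }

  remove-from-R₁ : ∀ {u N R₀ R₁ R₂} → Standard u (suc N) R₀ R₁ R₂ → suc N ∈ R₁ →
                   Removal u N (R₀ , R₁ , R₂)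
  remove-from-R₁ {u} {N} {R₀} {R₁} {R₂} std N+1∈ with max-last R₁ (suc N) incr₁ (entry≤₁ std) N+1∈
    where open Standard std
  ... | R₁′ , refl = r₁ , (R₀ , R₁′ , R₂) , std′ , addable , refl
    where
      open Standard std
      addable : length R₁′ < u + length R₀
      addable = subst (_≤ u + length R₀) (length-∷ʳ R₁′ (suc N)) shape₁
      shape₂′ : length R₂ ≤ length R₁′
      shape₂′ with length R₂ ≤? length R₁′
      ... | yes ≤ = ≤
      ... | no  ≰ = ⊥-elim (<-irrefl refl (<-≤-trans below (entry≤₂ std (nth-∈ R₂ j<len))))
        where
          j<len = ≰⇒> ≰
          below : suc N < nth R₂ (length R₁′)
          below = subst (_< nth R₂ (length R₁′)) (nth-∷ʳ-length R₁′ (suc N)) (col₁₂ (length R₁′) j<len)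
      std′ : Standard u N R₀ R₁′ R₂
      std′ = record
        { shape₁ = <⇒≤ addable
        ; shape₂ = shape₂′
        ; perm   = append-perm⁻ r₁ N (R₀ , R₁′ , R₂) perm
        ; incr₀  = incr₀
        ; incr₁  = Increasing-∷ʳ⁻ R₁′ (suc N) incr₁
        ; incr₂  = incr₂
        ; col₀₁  = λ j u≤j j<n → subst (nth R₀ (j ∸ u) <_) (nth-∷ʳ-< R₁′ (suc N) j<n)
                     (col₀₁ j u≤j (subst (j <_) (sym (length-∷ʳ R₁′ (suc N))) (m<n⇒m<1+n j<n)))
        ; col₁₂  = λ j j<n → subst (_< nth R₂ j)
                     (nth-∷ʳ-< R₁′ (suc N) (<-≤-trans j<n shape₂′)) (col₁₂ j j<n)
        }

  remove-from-R₂ : ∀ {u N R₀ R₁ R₂} → Standard u (suc N) R₀ R₁ R₂ → suc N ∈ R₂ →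
                   Removal u N (R₀ , R₁ , R₂)
  remove-from-R₂ {u} {N} {R₀} {R₁} {R₂} std N+1∈ with max-last R₂ (suc N) incr₂ (entry≤₂ std) N+1∈
    where open Standard std
  ... | R₂′ , refl = r₂ , (R₀ , R₁ , R₂′) , std′ , addable , refl
    where
      open Standard std
      addable : length R₂′ < length R₁
      addable = subst (_≤ length R₁) (length-∷ʳ R₂′ (suc N)) shape₂
      std′ : Standard u N R₀ R₁ R₂′
      std′ = record
        { shape₁ = shape₁
        ; shape₂ = <⇒≤ addable
        ; perm   = append-perm⁻ r₂ N (R₀ , R₁ , R₂′) perm
        ; incr₀  = incr₀
        ; incr₁  = incr₁
        ; incr₂  = Increasing-∷ʳ⁻ R₂′ (suc N) incr₂
        ; col₀₁  = col₀₁
        ; col₁₂  = λ j j<n → subst (nth R₁ j <_) (nth-∷ʳ-< R₂′ (suc N) j<n)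
                     (col₁₂ j (subst (j <_) (sym (length-∷ʳ R₂′ (suc N))) (m<n⇒m<1+n j<n)))
        }

  -- The largest entry N + 1 ends its row, and removing it leaves a standard filling.
  remove-largest : ∀ {u N} t → IsStandard u (suc N) t → Removal u N t
  remove-largest {u} {N} (R₀ , R₁ , R₂) std with ∈-++⁻ R₀ (largest∈ std)
  ... | inj₁ ∈R₀ = remove-from-R₀ std ∈R₀
  ... | inj₂ ∈R₁₂ with ∈-++⁻ R₁ ∈R₁₂
  ... | inj₁ ∈R₁ = remove-from-R₁ std ∈R₁
  ... | inj₂ ∈R₂ = remove-from-R₂ std ∈R₂

  optional-∈⁻ : ∀ {P : Set} (p? : Dec P) t {z} → z ∈ optional p? t → P × z ≡ t
  optional-∈⁻ (yes p) t (here refl) = p , refl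

  optional-∈⁺ : ∀ {P : Set} (p? : Dec P) t → P → t ∈ optional p? t
  optional-∈⁺ (yes _) t _ = here refl
  optional-∈⁺ (no ¬p) t p = ⊥-elim (¬p p)

  extensions-∈⁻ : ∀ u N s {t} → t ∈ extensions u N s → ∃ λ i → Addable u i s × t ≡ append i (suc N) s
  extensions-∈⁻ u N (R₀ , R₁ , R₂) (here refl) = r₀ , tt , refl
  extensions-∈⁻ u N s@(R₀ , R₁ , R₂) (there t∈)
    with ∈-++⁻ (optional (length R₁ <? u + length R₀) (append r₁ (suc N) s)) t∈
  ... | inj₁ t∈₁ = r₁ , optional-∈⁻ (length R₁ <? u + length R₀) _ t∈₁
  ... | inj₂ t∈₂ = r₂ , optional-∈⁻ (length R₂ <? length R₁) _ t∈₂

  extensions-∈⁺ : ∀ u N s i → Addable u i s → append i (suc N) s ∈ extensions u N s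
  extensions-∈⁺ u N (R₀ , R₁ , R₂) r₀ _        = here refl
  extensions-∈⁺ u N (R₀ , R₁ , R₂) r₁ addable =
    there (∈-++⁺ˡ (optional-∈⁺ (length R₁ <? u + length R₀) _ addable))
  extensions-∈⁺ u N s@(R₀ , R₁ , R₂) r₂ addable =
    there (∈-++⁺ʳ (optional (length R₁ <? u + length R₀) (append r₁ (suc N) s))
                  (optional-∈⁺ (length R₂ <? length R₁) _ addable))

  ∷ʳ-≢ : ∀ (R : List ℕ) x → R ∷ʳ x ≢ R
  ∷ʳ-≢ R x eq = 1+n≢n (trans (sym (length-∷ʳ R x)) (cong length eq))

  triple-injective : ∀ {a b c a′ b′ c′ : List ℕ} → (a , b , c) ≡ (a′ , b′ , c′) →
                     a ≡ a′ × b ≡ b′ × c ≡ c′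
  triple-injective refl = refl , refl , refl


  appended-fresh : ∀ {N} {R R′ : List ℕ} → (∀ {y} → y ∈ R → y ≤ N) → R ≡ R′ ∷ʳ suc N → ⊥
  appended-fresh {N} {R′ = R′} R≤N refl = 1+n≰n (R≤N (∈-∷ʳ R′ (suc N)))

  append-injective : ∀ {u N} i j s s′ → IsStandard u N s →
                     append i (suc N) s ≡ append j (suc N) s′ → s ≡ s′
  append-injective r₀ r₀ (a , b , c) (a′ , b′ , c′) std eq with triple-injective eq
  ... | a≡a′ , refl , refl = cong (λ R → R , b , c) (∷ʳ-injectiveˡ a a′ a≡a′)
  append-injective r₁ r₁ (a , b , c) (a′ , b′ , c′) std eq with triple-injective eq
  ... | refl , b≡b′ , refl = cong (λ R → a , R , c) (∷ʳ-injectiveˡ b b′ b≡b′)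
  append-injective r₂ r₂ (a , b , c) (a′ , b′ , c′) std eq with triple-injective eq
  ... | refl , refl , c≡c′ = cong (λ R → a , b , R) (∷ʳ-injectiveˡ c c′ c≡c′)
  append-injective r₀ r₁ _ _ std eq with triple-injective eq
  ... | _ , b≡ , _ = ⊥-elim (appended-fresh (entry≤₁ std) b≡)
  append-injective r₀ r₂ _ _ std eq with triple-injective eq
  ... | _ , _ , c≡ = ⊥-elim (appended-fresh (entry≤₂ std) c≡)
  append-injective r₁ r₀ _ _ std eq with triple-injective eq
  ... | a≡ , _ , _ = ⊥-elim (appended-fresh (entry≤₀ std) a≡)
  append-injective r₁ r₂ _ _ std eq with triple-injective eq
  ... | _ , _ , c≡ = ⊥-elim (appended-fresh (entry≤₂ std) c≡)
  append-injective r₂ r₀ _ _ std eq with triple-injective eq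
  ... | a≡ , _ , _ = ⊥-elim (appended-fresh (entry≤₀ std) a≡)
  append-injective r₂ r₁ _ _ std eq with triple-injective eq
  ... | _ , b≡ , _ = ⊥-elim (appended-fresh (entry≤₁ std) b≡)

  append₀≢append₁ : ∀ x s → append r₀ x s ≢ append r₁ x s
  append₀≢append₁ x (R₀ , R₁ , R₂) eq = ∷ʳ-≢ R₀ x (proj₁ (triple-injective eq))

  append₀≢append₂ : ∀ x s → append r₀ x s ≢ append r₂ x s
  append₀≢append₂ x (R₀ , R₁ , R₂) eq = ∷ʳ-≢ R₀ x (proj₁ (triple-injective eq))

  append₁≢append₂ : ∀ x s → append r₁ x s ≢ append r₂ x s
  append₁≢append₂ x (R₀ , R₁ , R₂) eq = ∷ʳ-≢ R₁ x (proj₁ (proj₂ (triple-injective eq)))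

  extensions-unique : ∀ u N s → Unique (extensions u N s)
  extensions-unique u N s@(R₀ , R₁ , R₂) with length R₁ <? u + length R₀ | length R₂ <? length R₁
  ... | yes _ | yes _ =
    (append₀≢append₁ (suc N) s ∷ append₀≢append₂ (suc N) s ∷ []) ∷ (append₁≢append₂ (suc N) s ∷ []) ∷ [] ∷ []
  ... | yes _ | no  _ = (append₀≢append₁ (suc N) s ∷ []) ∷ [] ∷ []
  ... | no  _ | yes _ = (append₀≢append₂ (suc N) s ∷ []) ∷ [] ∷ []
  ... | no  _ | no  _ = [] ∷ []

  standard-empty : ∀ u → IsStandard u 0 ([] , [] , [])
  standard-empty u = record
    { shape₁ = z≤n ; shape₂ = z≤n ; perm = ↭-refl
    ; incr₀ = λ _ () ; incr₁ = λ _ () ; incr₂ = λ _ ()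
    ; col₀₁ = λ _ _ () ; col₁₂ = λ _ () }

  standardRows-sound : ∀ u N {s} → s ∈ standardRows u N → IsStandard u N s
  standardRows-sound u zero    (here refl) = standard-empty u
  standardRows-sound u (suc N) s∈ with find (∈-concatMap⁻ (extensions u N) s∈)
  ... | t , t∈ , s∈ext with extensions-∈⁻ u N t s∈ext
  ... | i , addable , refl = append-standard i t (standardRows-sound u N t∈) addable

  length≡0 : ∀ (R : List ℕ) → length R ≡ 0 → R ≡ []
  length≡0 [] _ = refl

  standardRows-complete : ∀ u N s → IsStandard u N s → s ∈ standardRows u N
  standardRows-complete u zero (R₀ , R₁ , R₂) std
    with length≡0 R₀ (m+n≡0⇒m≡0 _ no-entries)
       | length≡0 R₁ (m+n≡0⇒m≡0 _ (m+n≡0⇒n≡0 (length R₀) no-entries))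
       | length≡0 R₂ (m+n≡0⇒n≡0 (length R₁) (m+n≡0⇒n≡0 (length R₀) no-entries))
    where
      no-entries : length R₀ + (length R₁ + length R₂) ≡ 0
      no-entries = trans (sym (trans (length-++ R₀) (cong (length R₀ +_) (length-++ R₁))))
                         (↭-length (Standard.perm std))
  ... | refl | refl | refl = here refl
  standardRows-complete u (suc N) t std with remove-largest t std
  ... | i , s , std′ , addable , refl =
    ∈-concatMap⁺ (extensions u N) (lose (standardRows-complete u N s std′) (extensions-∈⁺ u N s i addable))

  standardRows-standard : ∀ u N → All (IsStandard u N) (standardRows u N)
  standardRows-standard u N = All.tabulate (standardRows-sound u N)

  standardRows-unique : ∀ u N → Unique (standardRows u N)
  standardRows-unique u zero    = [] ∷ []
  standardRows-unique u (suc N) =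
    Unique-concatMap⁺ (extensions u N) (IsStandard u N) (standardRows u N) (standardRows-unique u N)
      (standardRows-standard u N) (λ s _ → extensions-unique u N s) disjoint
    where
      disjoint : ∀ s s′ → IsStandard u N s → IsStandard u N s′ →
                 ∀ t → t ∈ extensions u N s → t ∈ extensions u N s′ → s ≡ s′
      disjoint s s′ std _ t t∈ t∈′ with extensions-∈⁻ u N s t∈ | extensions-∈⁻ u N s′ t∈′
      ... | i , _ , refl | j , _ , eq = append-injective i j s s′ std eq


module ShapeEncoding where
  open import Data.Nat
  open import Data.Nat.Properties
  open import Data.Nat.ListAction using (sum)
  open import Data.List using (List; []; _∷_; _++_; length; concat; upTo)
  open import Data.List.Properties using (++-identityʳ; length-++; length-map; length-upTo)
  open import Data.List.Relation.Unary.All using (All; []; _∷_)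
  open import Data.List.Relation.Unary.Linked using (Linked; []; [-]; _∷_)
  open import Data.List.Relation.Binary.Permutation.Propositional using (_↭_)
  open import Data.List.Relation.Binary.Permutation.Propositional.Properties using (↭-length)
  open import Data.Product using (_×_; _,_; proj₁; proj₂)
  open import Data.Empty using (⊥-elim)
  open import Function using (_∘_)
  open import Relation.Binary.PropositionalEquality
  open import Defs
  open StandardRows

  oneRow : ℕ → List ℕ → List ℕ × Tableau
  oneRow zero    R₀ = [] , []
  oneRow (suc a) R₀ = suc a ∷ [] , R₀ ∷ []

  -- Empty rows are dropped, so that the shape has only positive parts.
  toTableau : ℕ → Rows → List ℕ × Tableau
  toTableau u (R₀ , R₁         , R₂@(_ ∷ _)) = (u + length R₀) ∷ length R₁ ∷ length R₂ ∷ [] , R₀ ∷ R₁ ∷ R₂ ∷ []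
  toTableau u (R₀ , R₁@(_ ∷ _) , [])         = (u + length R₀) ∷ length R₁ ∷ [] , R₀ ∷ R₁ ∷ []
  toTableau u (R₀ , []         , [])         = oneRow (u + length R₀) R₀

  rowsOf : List ℕ × Tableau → Rows
  rowsOf (_ , T) = row T 0 , row T 1 , row T 2

  u+length≡0 : ∀ u (R : List ℕ) → u + length R ≡ 0 → R ≡ []
  u+length≡0 u []      _  = refl
  u+length≡0 u (x ∷ R) eq = ⊥-elim (1+n≢0 (trans (sym (+-suc u (length R))) eq))

  rowsOf-toTableau : ∀ u s → rowsOf (toTableau u s) ≡ s
  rowsOf-toTableau u (R₀ , R₁     , _ ∷ _) = refl
  rowsOf-toTableau u (R₀ , _ ∷ _  , [])    = refl
  rowsOf-toTableau u (R₀ , []     , [])    = oneRow-rows (u + length R₀) refl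
    where
      oneRow-rows : ∀ a → a ≡ u + length R₀ → rowsOf (oneRow a R₀) ≡ (R₀ , [] , [])
      oneRow-rows zero    eq = cong (λ R → R , [] , []) (sym (u+length≡0 u R₀ (sym eq)))
      oneRow-rows (suc a) eq = refl

  toTableau-injective : ∀ u {s s′} → toTableau u s ≡ toTableau u s′ → s ≡ s′
  toTableau-injective u {s} {s′} eq = trans (sym (rowsOf-toTableau u s)) (trans (cong rowsOf eq) (rowsOf-toTableau u s′))

  paddedShape : ℕ → Rows → List ℕ
  paddedShape u (R₀ , R₁ , R₂) = (u + length R₀) ∷ length R₁ ∷ length R₂ ∷ []

  paddedTableau : Rows → Tableau
  paddedTableau (R₀ , R₁ , R₂) = R₀ ∷ R₁ ∷ R₂ ∷ []

  part-toTableau : ∀ u s i → part (proj₁ (toTableau u s)) i ≡ part (paddedShape u s) i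
  part-toTableau u (R₀ , R₁    , _ ∷ _) i                   = refl
  part-toTableau u (R₀ , _ ∷ _ , [])    0                   = refl
  part-toTableau u (R₀ , _ ∷ _ , [])    1                   = refl
  part-toTableau u (R₀ , _ ∷ _ , [])    2                   = refl
  part-toTableau u (R₀ , _ ∷ _ , [])    (suc (suc (suc i))) = refl
  part-toTableau u (R₀ , []    , [])    i                   = oneRow-part (u + length R₀) i
    where
      oneRow-part : ∀ a i → part (proj₁ (oneRow a R₀)) i ≡ part (a ∷ 0 ∷ 0 ∷ []) i
      oneRow-part zero    0                   = refl
      oneRow-part zero    1                   = refl
      oneRow-part zero    2                   = refl
      oneRow-part zero    (suc (suc (suc i))) = refl
      oneRow-part (suc a) 0                   = refl
      oneRow-part (suc a) 1                   = refl
      oneRow-part (suc a) 2                   = refl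
      oneRow-part (suc a) (suc (suc (suc i))) = refl

  row-toTableau : ∀ u s i → row (proj₂ (toTableau u s)) i ≡ row (paddedTableau s) i
  row-toTableau u (R₀ , R₁    , _ ∷ _) i                   = refl
  row-toTableau u (R₀ , _ ∷ _ , [])    0                   = refl
  row-toTableau u (R₀ , _ ∷ _ , [])    1                   = refl
  row-toTableau u (R₀ , _ ∷ _ , [])    2                   = refl
  row-toTableau u (R₀ , _ ∷ _ , [])    (suc (suc (suc i))) = refl
  row-toTableau u (R₀ , []    , [])    i                   = oneRow-row (u + length R₀) refl i
    where
      oneRow-row : ∀ a → a ≡ u + length R₀ → ∀ i →
                   row (proj₂ (oneRow a R₀)) i ≡ row (R₀ ∷ [] ∷ [] ∷ []) i
      oneRow-row zero    eq 0                   = sym (u+length≡0 u R₀ (sym eq))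
      oneRow-row zero    eq 1                   = refl
      oneRow-row zero    eq 2                   = refl
      oneRow-row zero    eq (suc (suc (suc i))) = refl
      oneRow-row (suc a) eq 0                   = refl
      oneRow-row (suc a) eq 1                   = refl
      oneRow-row (suc a) eq 2                   = refl
      oneRow-row (suc a) eq (suc (suc (suc i))) = refl

  concat-toTableau : ∀ u s → concat (proj₂ (toTableau u s)) ≡ entries s
  concat-toTableau u (R₀ , R₁    , R₂@(_ ∷ _)) = cong (λ R → R₀ ++ R₁ ++ R) (++-identityʳ R₂)
  concat-toTableau u (R₀ , _ ∷ _ , [])         = refl
  concat-toTableau u (R₀ , []    , [])         = oneRow-concat (u + length R₀) refl
    where
      oneRow-concat : ∀ a → a ≡ u + length R₀ → concat (proj₂ (oneRow a R₀)) ≡ R₀ ++ [] ++ []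
      oneRow-concat zero    eq rewrite u+length≡0 u R₀ (sym eq) = refl
      oneRow-concat (suc a) eq = refl

  numRows-toTableau : ∀ u s → length (proj₂ (toTableau u s)) ≡ length (proj₁ (toTableau u s))
  numRows-toTableau u (R₀ , R₁    , _ ∷ _) = refl
  numRows-toTableau u (R₀ , _ ∷ _ , [])    = refl
  numRows-toTableau u (R₀ , []    , [])    with u + length R₀
  ... | zero  = refl
  ... | suc a = refl

  toTableau-≤3 : ∀ u s → length (proj₁ (toTableau u s)) ≤ 3
  toTableau-≤3 u (R₀ , R₁    , _ ∷ _) = ≤-refl
  toTableau-≤3 u (R₀ , _ ∷ _ , [])    = s≤s (s≤s z≤n)
  toTableau-≤3 u (R₀ , []    , [])    with u + length R₀
  ... | zero  = z≤n
  ... | suc a = s≤s z≤n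

  length-entries : ∀ (R₀ R₁ R₂ : List ℕ) →
                   length (R₀ ++ R₁ ++ R₂) ≡ length R₀ + (length R₁ + length R₂)
  length-entries R₀ R₁ R₂ = trans (length-++ R₀) (cong (length R₀ +_) (length-++ R₁))

  sum-toTableau : ∀ u s → sum (proj₁ (toTableau u s)) ≡ u + length (entries s)
  sum-toTableau u (R₀ , R₁ , R₂@(_ ∷ _)) = begin
      u + length R₀ + (length R₁ + (length R₂ + 0))
    ≡⟨ cong (λ c → u + length R₀ + (length R₁ + c)) (+-identityʳ (length R₂)) ⟩
      u + length R₀ + (length R₁ + length R₂)
    ≡⟨ +-assoc u (length R₀) _ ⟩
      u + (length R₀ + (length R₁ + length R₂))
    ≡⟨ cong (u +_) (length-entries R₀ R₁ R₂) ⟨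
      u + length (R₀ ++ R₁ ++ R₂)
    ∎
    where open ≡-Reasoning
  sum-toTableau u (R₀ , R₁@(_ ∷ _) , []) = begin
      u + length R₀ + (length R₁ + 0)
    ≡⟨ +-assoc u (length R₀) _ ⟩
      u + (length R₀ + (length R₁ + 0))
    ≡⟨ cong (u +_) (length-entries R₀ R₁ []) ⟨
      u + length (R₀ ++ R₁ ++ [])
    ∎
    where open ≡-Reasoning
  sum-toTableau u (R₀ , [] , []) =
    trans (oneRow-sum (u + length R₀)) (trans (+-assoc u (length R₀) 0) (cong (u +_) (sym (length-++ R₀))))
    where oneRow-sum : ∀ a → sum (proj₁ (oneRow a R₀)) ≡ a + 0
          oneRow-sum zero    = refl
          oneRow-sum (suc a) = refl

  length-oneTo : ∀ N → length (oneTo N) ≡ N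
  length-oneTo N = trans (length-map suc (upTo N)) (length-upTo N)

  Standard⇒length : ∀ {u N R₀ R₁ R₂} → Standard u N R₀ R₁ R₂ → length (R₀ ++ R₁ ++ R₂) ≡ N
  Standard⇒length std = trans (↭-length (Standard.perm std)) (length-oneTo _)

  toTableau-partition : ∀ u N s → IsStandard u N s → IsPartitionOf (u + N) (proj₁ (toTableau u s))
  toTableau-partition u N s@(R₀ , R₁ , R₂@(_ ∷ _)) std =
    (shape₁ ∷ shape₂ ∷ [-]) ,
    (≤-trans (s≤s z≤n) (≤-trans shape₂ shape₁) ∷ ≤-trans (s≤s z≤n) shape₂ ∷ s≤s z≤n ∷ []) ,
    trans (sum-toTableau u s) (cong (u +_) (Standard⇒length std))
    where open Standard std
  toTableau-partition u N s@(R₀ , R₁@(_ ∷ _) , []) std =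
    (shape₁ ∷ [-]) ,
    (≤-trans (s≤s z≤n) shape₁ ∷ s≤s z≤n ∷ []) ,
    trans (sum-toTableau u s) (cong (u +_) (Standard⇒length std))
    where open Standard std
  toTableau-partition u N s@(R₀ , [] , []) std = oneRow-partition (u + length R₀) refl
    where
      length-R₀ : length R₀ ≡ N
      length-R₀ = trans (sym (trans (length-entries R₀ [] []) (+-identityʳ _))) (Standard⇒length std)
      oneRow-partition : ∀ a → a ≡ u + length R₀ → IsPartitionOf (u + N) (proj₁ (oneRow a R₀))
      oneRow-partition zero    eq = [] , [] , trans eq (cong (u +_) length-R₀)
      oneRow-partition (suc a) eq =
        [-] , (s≤s z≤n ∷ []) , trans (+-identityʳ (suc a)) (trans eq (cong (u +_) length-R₀))

  part-onePart : ∀ u i → part (u ∷ []) i ≡ part (onePart u) i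
  part-onePart zero    zero    = refl
  part-onePart zero    (suc i) = refl
  part-onePart (suc u) i       = refl

  sum-onePart : ∀ u → sum (onePart u) ≡ u
  sum-onePart zero    = refl
  sum-onePart (suc u) = +-identityʳ (suc u)

  part-≥length : ∀ (λ′ : List ℕ) {i} → length λ′ ≤ i → part λ′ i ≡ 0
  part-≥length []       _         = refl
  part-≥length (p ∷ ps) {suc i} (s≤s ≤i) = part-≥length ps ≤i

  row-≥length : ∀ (T : Tableau) {i} → length T ≤ i → row T i ≡ []
  row-≥length []      _         = refl
  row-≥length (R ∷ T) {suc i} (s≤s ≤i) = row-≥length T ≤i

  part-injective : ∀ {λ′ λ″ : List ℕ} → All (1 ≤_) λ′ → All (1 ≤_) λ″ →
                   (∀ i → part λ′ i ≡ part λ″ i) → λ′ ≡ λ″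
  part-injective []        []        _  = refl
  part-injective (1≤p ∷ _) []        eq = ⊥-elim (<⇒≢ 1≤p (sym (eq 0)))
  part-injective []        (1≤q ∷ _) eq = ⊥-elim (<⇒≢ 1≤q (eq 0))
  part-injective (_ ∷ ps)  (_ ∷ qs)  eq = cong₂ _∷_ (eq 0) (part-injective ps qs (eq ∘ suc))

  row-injective : ∀ {T T′ : Tableau} → length T ≡ length T′ → (∀ i → row T i ≡ row T′ i) → T ≡ T′
  row-injective {[]}    {[]}     _  _  = refl
  row-injective {R ∷ T} {R′ ∷ T′} eq rows = cong₂ _∷_ (rows 0) (row-injective (suc-injective eq) (rows ∘ suc))

  Linked-part : ∀ {λ′ : List ℕ} → Linked _≥_ λ′ → ∀ i → part λ′ (suc i) ≤ part λ′ i
  Linked-part []      i       = z≤n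
  Linked-part [-]     zero    = z≤n
  Linked-part [-]     (suc i) = z≤n
  Linked-part (r ∷ l) zero    = r
  Linked-part (r ∷ l) (suc i) = Linked-part l i

  concat-≤3 : ∀ (T : Tableau) → length T ≤ 3 → concat T ≡ row T 0 ++ row T 1 ++ row T 2
  concat-≤3 []                  _ = refl
  concat-≤3 (R₀ ∷ [])           _ = refl
  concat-≤3 (R₀ ∷ R₁ ∷ [])      _ = refl
  concat-≤3 (R₀ ∷ R₁ ∷ R₂ ∷ []) _ = cong (λ R → R₀ ++ R₁ ++ R) (++-identityʳ R₂)
  concat-≤3 (_ ∷ _ ∷ _ ∷ _ ∷ _) (s≤s (s≤s (s≤s ())))

  -- The local conditions of a skew tableau only see the parts of the shapes and the rows.
  IsSkewSYT-transport : ∀ {λ′ λ″ μ μ′ : List ℕ} {T T′ : Tableau} →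
    (∀ i → part λ′ i ≡ part λ″ i) → (∀ i → part μ i ≡ part μ′ i) → (∀ i → row T i ≡ row T′ i) →
    length T′ ≡ length λ″ → concat T′ ↭ oneTo (sum λ″ ∸ sum μ′) →
    IsSkewSYT λ′ μ T → IsSkewSYT λ″ μ′ T′
  IsSkewSYT-transport {λ′} {λ″} {μ} {μ′} {T} {T′} λ≗ μ≗ T≗ numRows′ entries′ syt = record
    { numRows   = numRows′
    ; rowLength = λ i → subst₂ (λ R l → length R ≡ l) (T≗ i) (cong₂ _∸_ (λ≗ i) (μ≗ i)) (rowLength i)
    ; entries   = entries′
    ; rowIncr   = λ i j in₁ in₂ →
        subst₂ _<_ (entry≡ i j) (entry≡ i (suc j)) (rowIncr i j (back in₁) (back in₂))
    ; colIncr   = λ i j in₁ in₂ →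
        subst₂ _<_ (entry≡ i j) (entry≡ (suc i) j) (colIncr i j (back in₁) (back in₂))
    }
    where
      open IsSkewSYT syt using (rowLength; rowIncr; colIncr)
      back : ∀ {i j} → InSkew λ″ μ′ i j → InSkew λ′ μ i j
      back {i} {j} (μ≤j , j<λ) = subst (_≤ j) (sym (μ≗ i)) μ≤j , subst (j <_) (sym (λ≗ i)) j<λ
      entry≡ : ∀ i j → entry μ T i j ≡ entry μ′ T′ i j
      entry≡ i j = cong₂ (λ R m → nth R (j ∸ m)) (T≗ i) (μ≗ i)

  padded-SYT : ∀ {u N R₀ R₁ R₂} → Standard u N R₀ R₁ R₂ →
    IsSkewSYT (paddedShape u (R₀ , R₁ , R₂)) (u ∷ []) (paddedTableau (R₀ , R₁ , R₂))
  padded-SYT {u} {N} {R₀} {R₁} {R₂} std = record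
    { numRows   = refl
    ; rowLength = rowLength
    ; entries   = subst₂ _↭_ (sym (cong (λ R → R₀ ++ R₁ ++ R) (++-identityʳ R₂))) (cong oneTo (sym size)) perm
    ; rowIncr   = rowIncr
    ; colIncr   = colIncr
    }
    where
      open Standard std
      λ′ = paddedShape u (R₀ , R₁ , R₂)
      T = paddedTableau (R₀ , R₁ , R₂)
      size : sum λ′ ∸ (u + 0) ≡ N
      size = begin
          u + length R₀ + (length R₁ + (length R₂ + 0)) ∸ (u + 0)
        ≡⟨ cong₂ (λ c v → u + length R₀ + (length R₁ + c) ∸ v) (+-identityʳ (length R₂)) (+-identityʳ u) ⟩
          u + length R₀ + (length R₁ + length R₂) ∸ u
        ≡⟨ cong (_∸ u) (+-assoc u (length R₀) _) ⟩
          u + (length R₀ + (length R₁ + length R₂)) ∸ u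
        ≡⟨ m+n∸m≡n u _ ⟩
          length R₀ + (length R₁ + length R₂)
        ≡⟨ length-entries R₀ R₁ R₂ ⟨
          length (R₀ ++ R₁ ++ R₂)
        ≡⟨ Standard⇒length std ⟩
          N
        ∎
        where open ≡-Reasoning
      rowLength : ∀ i → length (row T i) ≡ part λ′ i ∸ part (u ∷ []) i
      rowLength 0                   = sym (m+n∸m≡n u (length R₀))
      rowLength 1                   = refl
      rowLength 2                   = refl
      rowLength (suc (suc (suc i))) = refl
      rowIncr : ∀ i j → InSkew λ′ (u ∷ []) i j → InSkew λ′ (u ∷ []) i (suc j) →
                entry (u ∷ []) T i j < entry (u ∷ []) T i (suc j)
      rowIncr 0 j (u≤j , _) (_ , j+1<u+n) = subst (λ c → nth R₀ (j ∸ u) < nth R₀ c) (sym step)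
        (incr₀ (j ∸ u) (subst (_< length R₀) step (j∸u<n (m≤n⇒m≤1+n u≤j) j+1<u+n)))
        where step = +-∸-assoc 1 u≤j
      rowIncr 1                   j _ (_ , j+1<n) = incr₁ j j+1<n
      rowIncr 2                   j _ (_ , j+1<n) = incr₂ j j+1<n
      rowIncr (suc (suc (suc i))) j (_ , ()) _
      colIncr : ∀ i j → InSkew λ′ (u ∷ []) i j → InSkew λ′ (u ∷ []) (suc i) j →
                entry (u ∷ []) T i j < entry (u ∷ []) T (suc i) j
      colIncr 0                   j (u≤j , _) (_ , j<n) = col₀₁ j u≤j j<n
      colIncr 1                   j _         (_ , j<n) = col₁₂ j j<n
      colIncr 2                   j _         (_ , ())
      colIncr (suc (suc (suc i))) j (_ , ())  _

  toTableau-counted : ∀ u N s → IsStandard u N s → Counted (u + N) (suc u) (toTableau u s)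
  toTableau-counted u N s@(R₀ , R₁ , R₂) std =
    partition , toTableau-≤3 u s , onePart⊆ ,
    IsSkewSYT-transport (λ i → sym (part-toTableau u s i)) (part-onePart u) (λ i → sym (row-toTableau u s i))
                        (numRows-toTableau u s) entries′ (padded-SYT std)
    where
      partition = toTableau-partition u N s std
      size : sum (proj₁ (toTableau u s)) ∸ sum (onePart u) ≡ N
      size = trans (cong₂ _∸_ (proj₂ (proj₂ partition)) (sum-onePart u)) (m+n∸m≡n u N)
      entries′ : concat (proj₂ (toTableau u s)) ↭ oneTo (sum (proj₁ (toTableau u s)) ∸ sum (onePart u))
      entries′ = subst₂ _↭_ (sym (concat-toTableau u s)) (cong oneTo (sym size)) (Standard.perm std)
      onePart⊆ : onePart u ⊆ₚ proj₁ (toTableau u s)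
      onePart⊆ zero    = subst₂ _≤_ (part-onePart u 0) (sym (part-toTableau u s 0)) (m≤m+n u (length R₀))
      onePart⊆ (suc i) = subst (_≤ part (proj₁ (toTableau u s)) (suc i)) (part-onePart u (suc i)) z≤n

  module _ {u n λ′ T} (counted : Counted n (suc u) (λ′ , T)) where
    private
      linked   = proj₁ (proj₁ counted)
      size     = proj₂ (proj₂ (proj₁ counted))
      len≤3    = proj₁ (proj₂ counted)
      onePart⊆ = proj₁ (proj₂ (proj₂ counted))
      syt      = proj₂ (proj₂ (proj₂ counted))
      R₀ = row T 0
      R₁ = row T 1
      R₂ = row T 2
      sum-u : sum (onePart u) ≡ u + 0
      sum-u = trans (sum-onePart u) (sym (+-identityʳ u))
      syt′ : IsSkewSYT λ′ (u ∷ []) T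
      syt′ = IsSkewSYT-transport (λ _ → refl) (sym ∘ part-onePart u) (λ _ → refl) (IsSkewSYT.numRows syt)
               (subst (λ m → concat T ↭ oneTo (sum λ′ ∸ m)) sum-u (IsSkewSYT.entries syt)) syt
      open IsSkewSYT syt′ using (numRows; rowLength; rowIncr; colIncr)

    paddedShape-rowsOf : ∀ i → part (paddedShape u (R₀ , R₁ , R₂)) i ≡ part λ′ i
    paddedShape-rowsOf 0                   = trans (cong (u +_) (rowLength 0)) (m+[n∸m]≡n u≤λ₀)
      where u≤λ₀ = subst (_≤ part λ′ 0) (sym (part-onePart u 0)) (onePart⊆ 0)
    paddedShape-rowsOf 1                   = rowLength 1
    paddedShape-rowsOf 2                   = rowLength 2
    paddedShape-rowsOf (suc (suc (suc i))) = sym (part-≥length λ′ (≤-trans len≤3 (s≤s (s≤s (s≤s z≤n)))))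

    counted⇒standard : IsStandard u (n ∸ u) (R₀ , R₁ , R₂)
    counted⇒standard = record
      { shape₁ = subst₂ _≤_ (sym (rowLength 1)) (sym (paddedShape-rowsOf 0)) (Linked-part linked 0)
      ; shape₂ = subst₂ _≤_ (sym (rowLength 2)) (sym (rowLength 1)) (Linked-part linked 1)
      ; perm   = subst₂ _↭_ (concat-≤3 T (subst (_≤ 3) (sym numRows) len≤3))
                            (cong oneTo (cong₂ _∸_ size (+-identityʳ u))) (IsSkewSYT.entries syt′)
      ; incr₀  = incr₀
      ; incr₁  = λ j j+1<n → rowIncr 1 j (z≤n , subst (j <_) (rowLength 1) (<-trans (n<1+n j) j+1<n))
                                          (z≤n , subst (suc j <_) (rowLength 1) j+1<n)
      ; incr₂  = λ j j+1<n → rowIncr 2 j (z≤n , subst (j <_) (rowLength 2) (<-trans (n<1+n j) j+1<n))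
                                          (z≤n , subst (suc j <_) (rowLength 2) j+1<n)
      ; col₀₁  = λ j u≤j j<n → colIncr 0 j
                                   (u≤j , <-≤-trans (subst (j <_) (rowLength 1) j<n) (Linked-part linked 0))
                                            (z≤n , subst (j <_) (rowLength 1) j<n)
      ; col₁₂  = λ j j<n → colIncr 1 j (z≤n , <-≤-trans (subst (j <_) (rowLength 2) j<n) (Linked-part linked 1))
                                        (z≤n , subst (j <_) (rowLength 2) j<n)
      }
      where
        shifted< : ∀ {k} → k < length R₀ → k + u < part λ′ 0
        shifted< {k} k<n = subst (k + u <_) (trans (+-comm (length R₀) u) (paddedShape-rowsOf 0)) (+-monoˡ-< u k<n)
        incr₀ : Increasing R₀
        incr₀ j j+1<n = subst₂ _<_ (cong (nth R₀) (m+n∸n≡m j u)) (cong (nth R₀) (m+n∸n≡m (suc j) u))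
          (rowIncr 0 (j + u) (m≤n+m u j , shifted< (<-trans (n<1+n j) j+1<n))
                             (m≤n⇒m≤1+n (m≤n+m u j) , shifted< j+1<n))

    toTableau-rowsOf : toTableau u (R₀ , R₁ , R₂) ≡ (λ′ , T)
    toTableau-rowsOf = cong₂ _,_ shape≡ (row-injective numRows≡ rows≡)
      where
        s = (R₀ , R₁ , R₂)
        shape≡ : proj₁ (toTableau u s) ≡ λ′
        shape≡ = part-injective (proj₁ (proj₂ (toTableau-partition u (n ∸ u) s counted⇒standard)))
                                (proj₁ (proj₂ (proj₁ counted)))
                                (λ i → trans (part-toTableau u s i) (paddedShape-rowsOf i))
        numRows≡ : length (proj₂ (toTableau u s)) ≡ length T
        numRows≡ = trans (numRows-toTableau u s) (trans (cong length shape≡) (sym numRows))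
        rows≡ : ∀ i → row (proj₂ (toTableau u s)) i ≡ row T i
        rows≡ 0                   = row-toTableau u s 0
        rows≡ 1                   = row-toTableau u s 1
        rows≡ 2                   = row-toTableau u s 2
        rows≡ (suc (suc (suc i))) = trans (row-toTableau u s (suc (suc (suc i))))
          (sym (row-≥length T (≤-trans (subst (_≤ 3) (sym numRows) len≤3) (s≤s (s≤s (s≤s z≤n))))))


module Counting where
  open import Data.Nat
  open import Data.Nat.Properties
  open import Data.Nat.ListAction using (sum)
  open import Data.Nat.ListAction.Properties using (sum-++)
  open import Data.List using (List; []; _∷_; _++_; _∷ʳ_; length; map; concatMap)
  open import Data.List.Properties using (map-++)
  open import Data.List.Relation.Unary.All using (All; []; _∷_)
  open import Data.Product using (_,_)
  open import Relation.Nullary using (Dec; yes; no; ¬_)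
  open import Relation.Binary.PropositionalEquality
  open LatticePaths using (prev; chamberWalks)
  open StandardRows

  sum-map-concatMap : ∀ {A B : Set} (f : B → ℕ) (g : A → List B) xs →
    sum (map f (concatMap g xs)) ≡ sum (map (λ x → sum (map f (g x))) xs)
  sum-map-concatMap f g []       = refl
  sum-map-concatMap f g (x ∷ xs) =
    trans (cong sum (map-++ f (g x) (concatMap g xs)))
          (trans (sum-++ (map f (g x)) (map f (concatMap g xs))) (cong (sum (map f (g x)) +_) (sum-map-concatMap f g xs)))

  sum-map-cong : ∀ {A : Set} {P : A → Set} {f g : A → ℕ} xs → All P xs → (∀ x → P x → f x ≡ g x) →
    sum (map f xs) ≡ sum (map g xs)
  sum-map-cong []       []         f≗g = refl
  sum-map-cong (x ∷ xs) (px ∷ pxs) f≗g = cong₂ _+_ (f≗g x px) (sum-map-cong xs pxs f≗g)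

  length-sum-map : ∀ {A : Set} (xs : List A) → length xs ≡ sum (map (λ _ → 1) xs)
  length-sum-map []       = refl
  length-sum-map (x ∷ xs) = cong suc (length-sum-map xs)

  prev-∸ : ∀ f {a b} → b < a → prev f (a ∸ b) ≡ f (a ∸ suc b)
  prev-∸ f {suc a} {zero}  _         = refl
  prev-∸ f {suc a} {suc b} (s≤s b<a) = prev-∸ f b<a

  prev-∸-≥ : ∀ f {a b} → ¬ b < a → prev f (a ∸ b) ≡ 0
  prev-∸-≥ f b≮a rewrite m≤n⇒m∸n≡0 (≮⇒≥ b≮a) = refl

  walksFrom : ℕ → ℕ → Rows → ℕ
  walksFrom u m (R₀ , R₁ , R₂) = chamberWalks m ((u + length R₀) ∸ length R₁) (length R₁ ∸ length R₂)

  extensions-walks : ∀ u N m s → IsStandard u N s →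
    sum (map (walksFrom u m) (extensions u N s)) ≡ walksFrom u (suc m) s
  extensions-walks u N m s@(R₀ , R₁ , R₂) std = by-cases (b <? a) (c <? b)
    where
      open Standard std using (shape₁; shape₂)
      x = suc N
      W = chamberWalks m
      a = u + length R₀
      b = length R₁
      c = length R₂
      P = a ∸ b
      Q = b ∸ c
      grow₀ : walksFrom u m (R₀ ∷ʳ x , R₁ , R₂) ≡ W (suc P) Q
      grow₀ = cong (λ p → W p Q) (trans (cong (λ l → (u + l) ∸ b) (length-∷ʳ R₀ x))
                                        (trans (cong (_∸ b) (+-suc u (length R₀))) (+-∸-assoc 1 shape₁)))
      grow₁ : b < a → walksFrom u m (R₀ , R₁ ∷ʳ x , R₂) ≡ prev (λ p → W p (suc Q)) P
      grow₁ b<a = trans (cong₂ W (cong (a ∸_) (length-∷ʳ R₁ x))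
                                 (trans (cong (_∸ c) (length-∷ʳ R₁ x)) (+-∸-assoc 1 shape₂)))
                        (sym (prev-∸ (λ p → W p (suc Q)) b<a))
      grow₂ : c < b → walksFrom u m (R₀ , R₁ , R₂ ∷ʳ x) ≡ prev (W P) Q
      grow₂ c<b = trans (cong (W P) (cong (b ∸_) (length-∷ʳ R₂ x))) (sym (prev-∸ (W P) c<b))
      assemble : ∀ w y z → w ≡ W (suc P) Q → y ≡ prev (λ p → W p (suc Q)) P → z ≡ prev (W P) Q →
                 w + (y + z) ≡ chamberWalks (suc m) P Q
      assemble w y z refl refl refl = sym (+-assoc (W (suc P) Q) y z)
      by-cases : (b<a? : Dec (b < a)) (c<b? : Dec (c < b)) →
        sum (map (walksFrom u m)
                 (append r₀ x s ∷ (optional b<a? (append r₁ x s) ++ optional c<b? (append r₂ x s)))) ≡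
        chamberWalks (suc m) P Q
      by-cases (yes b<a) (yes c<b) = assemble _ _ _ grow₀ (grow₁ b<a) (trans (+-identityʳ _) (grow₂ c<b))
      by-cases (yes b<a) (no  c≮b) = assemble _ _ 0 grow₀ (grow₁ b<a) (sym (prev-∸-≥ (W P) c≮b))
      by-cases (no  b≮a) (yes c<b) =
        assemble _ 0 _ grow₀ (sym (prev-∸-≥ (λ p → W p (suc Q)) b≮a)) (trans (+-identityʳ _) (grow₂ c<b))
      by-cases (no  b≮a) (no  c≮b) =
        assemble _ 0 0 grow₀ (sym (prev-∸-≥ (λ p → W p (suc Q)) b≮a)) (sym (prev-∸-≥ (W P) c≮b))

  -- Split each walk of N + m steps after its first N steps.
  standardRows-walks : ∀ u N m → sum (map (walksFrom u m) (standardRows u N)) ≡ chamberWalks (N + m) u 0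
  standardRows-walks u zero    m = trans (+-identityʳ _) (cong (λ p → chamberWalks m p 0) (+-identityʳ u))
  standardRows-walks u (suc N) m = begin
      sum (map (walksFrom u m) (concatMap (extensions u N) (standardRows u N)))
    ≡⟨ sum-map-concatMap (walksFrom u m) (extensions u N) (standardRows u N) ⟩
      sum (map (λ s → sum (map (walksFrom u m) (extensions u N s))) (standardRows u N))
    ≡⟨ sum-map-cong (standardRows u N) (standardRows-standard u N) (extensions-walks u N m) ⟩
      sum (map (walksFrom u (suc m)) (standardRows u N))
    ≡⟨ standardRows-walks u N (suc m) ⟩
      chamberWalks (N + suc m) u 0
    ≡⟨ cong (λ k → chamberWalks k u 0) (+-suc N m) ⟩
      chamberWalks (suc N + m) u 0
    ∎
    where open ≡-Reasoning

  length-standardRows : ∀ u N → length (standardRows u N) ≡ chamberWalks N u 0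
  length-standardRows u N = trans (length-sum-map (standardRows u N))
    (trans (standardRows-walks u N 0) (cong (λ k → chamberWalks k u 0) (+-identityʳ N)))


open import Defs
open import Data.Nat using (ℕ; _+_; _∸_; _≤_; suc)
open import Data.Nat.Properties using (m+[n∸m]≡n)
open import Data.Integer using (ℤ; +_; _*_)
open import Data.List using (List; length; map)
open import Data.List.Properties using (length-map)
open import Data.List.Membership.Propositional using (_∈_)
open import Data.List.Membership.Propositional.Properties using (∈-map⁻; ∈-map⁺)
open import Data.List.Relation.Unary.Unique.Propositional using (Unique)
import Data.List.Relation.Unary.Unique.Propositional.Properties as Unique
open import Data.Product using (Σ; _×_; _,_)
open import Function.Bundles using (_⇔_; mk⇔)
open import Relation.Binary.PropositionalEquality using (_≡_; refl; sym; trans; cong; subst)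
open LatticePaths using (chamberWalks-axis)
open GeneratingFunction using (IsRGenFun-motzkin)
open StandardRows using (standardRows; standardRows-unique; standardRows-sound; standardRows-complete)
open ShapeEncoding using (toTableau; toTableau-injective; toTableau-counted; rowsOf; counted⇒standard; toTableau-rowsOf)
open Counting using (length-standardRows)

theorem2p1 : (k n : ℕ) → 1 ≤ k → k ∸ 1 ≤ n →
    (r : Series) → IsRGenFun r →
    Σ (List (List ℕ × Tableau)) λ L →
      Unique L × (∀ x → (x ∈ L) ⇔ Counted n k x) ×
      (+ length L ≡ sumℤ k (λ i → r k i * + motzkin (i + (n ∸ (k ∸ 1)))))
theorem2p1 (suc u) n _ u≤n r r-gen =
  L , Unique.map⁺ (toTableau-injective u) (standardRows-unique u N) , membership , count
  where
    N = n ∸ u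
    L = map (toTableau u) (standardRows u N)
    membership : ∀ x → (x ∈ L) ⇔ Counted n (suc u) x
    membership x = mk⇔ to from
      where
        to : x ∈ L → Counted n (suc u) x
        to x∈L with ∈-map⁻ (toTableau u) x∈L
        ... | s , s∈ , refl = subst (λ m → Counted m (suc u) (toTableau u s)) (m+[n∸m]≡n u≤n)
                                    (toTableau-counted u N s (standardRows-sound u N s∈))
        from : Counted n (suc u) x → x ∈ L
        from counted = subst (_∈ L) (toTableau-rowsOf counted)
          (∈-map⁺ (toTableau u) (standardRows-complete u N (rowsOf x) (counted⇒standard counted)))
    count : + length L ≡ sumℤ (suc u) (λ i → r (suc u) i * + motzkin (i + N))
    count = trans (cong +_ (trans (length-map (toTableau u) (standardRows u N))
                                  (trans (length-standardRows u N) (chamberWalks-axis N u))))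
                  (sym (IsRGenFun-motzkin r r-gen (suc u) N))
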